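{- Let $N$ be an integer. (i) For each odd integer $p\ge3$ and each $v\in\ker{}^tE_{N-p,3}$, one has $v'\cdot{}^tE_{N,4}=\Phi_p(v)$ where $v'=\Psi_p(v)$, and $\Phi_p(v)\in\ker{}^tE^{(3)}_{N,4}$. (ii) For each even integer $p\ge6$, each $(p_1,p_2)\in\mathrm S_{p,2}$ and each $v\in\ker{}^tE_{N-p,2}$, \[\Psi_{p_1,p_2}(v)\cdot{}^tE_{N,4}\cdot{}^tE^{(3)}_{N,4}=\sum_{(t_1,t_2)\in\mathrm S_{p,2}}e\tbinom{t_1,t_2}{p_1,p_2}\,\Phi_{t_1,t_2}(v),\] and this vector lies in $\ker{}^tE^{(2)}_{N,4}$.
   Context: $\mathrm S_{N,r}=\{(n_1,\dots,n_r)\in\mathbb Z^r:\sum n_i=N,\ n_i\text{ odd},\ n_i\ge3\}$; $\mathsf{Vect}_{N,r}$ = rational row vectors indexed by $\mathrm S_{N,r}$; a square matrix $M$ indexed by $\mathrm S_{N,r}$ (rows, columns) acts by $v\mapsto vM$, $\ker M=\{v: vM=0\}$, ${}^tM$ is the transpose. For $m\ge1$, $g\in\mathbb Q[x_1,\dots,x_s]$: $x_1^{m-1}\,\underline{\circ}\, g=\sum_{i=0}^{s}(x_{i+1}-x_i)^{m-1}g(x_1,\dots,\widehat{x_{i+1}},\dots,x_{s+1})+(-1)^{m}\sum_{i=1}^{s}(x_i-x_{i+1})^{m-1}g(x_1,\dots,\widehat{x_i},\dots,x_{s+1})$ ($x_0=0$). $e\binom{m_1,\dots,m_r}{n_1,\dots,n_r}$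 (for $\sum n_i=\sum m_i$) is the coefficient of $x_1^{n_1-1}\cdots x_r^{n_r-1}$ in $x_1^{m_1-1}\,\underline{\circ}\,(x_1^{m_2-1}\cdots x_{r-1}^{m_r-1})$. $E_{N,r}$ has entries $e\binom{m_1,\dots,m_r}{n_1,\dots,n_r}$ (row $(m_i)$, column $(n_i)$, both in $\mathrm S_{N,r}$); for $2\le q\le r$, $E^{(q)}_{N,r}$ has entries $\delta\binom{m_1,\dots,m_{r-q}}{n_1,\dots,n_{r-q}}e\binom{m_{r-q+1},\dots,m_r}{n_{r-q+1},\dots,n_r}$, where $\delta$ of tuples is $1$ iff they coincide. $\mathbf F=\mathbb Q\langle z_3,z_5,z_7,\dots\rangle$ (noncommutative polynomials, empty word $=1$), $\mathbf F_{N,r}$ = span of words $z_{n_1}\cdots z_{n_r}$, $(n_i)\in\mathrm S_{N,r}$. Shuffle product (bilinear): $z_{n_1}\cdots z_{n_r}\,\text{ш}\,z_{n_{r+1}}\cdots z_{n_{r+s}}=\sum_\sigma z_{n_{\sigma^{ -1}(1)}}\cdots z_{n_{\sigma^{ -1}(r+s)}}$ over permutations $\sigma$ of $\{1,\dots,r+s\}$ with $\sigma(1)<\cdots<\sigma(r)$ and $\sigma(r+1)<\cdots<\sigma(r+s)$. $\pi_2:\mathsf{Vect}_{N,r}\to\mathbf F_{N,r}$, $(a_{\mathbf n})\mapsto\sum a_{\mathbf n}z_{n_1}\cdots z_{n_r}$. For a word $w=z_{p_1}\cdots z_{p_k}\in\mathbf F_{P,k}$, $\Psi_{p_1,\dots,p_k}:\mathsf{Vect}_{N',r'}\to\mathsf{Vect}_{N'+P,r'+k}$,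 $v\mapsto\pi_2^{ -1}(\pi_2(v)\,\text{ш}\,w)$. For $(p_1,\dots,p_{r-q})\in\mathrm S_{p,r-q}$, $\Phi_{p_1,\dots,p_{r-q}}:\mathsf{Vect}_{N-p,q}\to\mathsf{Vect}_{N,r}$ sends $(a_{n_1,\dots,n_q})$ to the vector with $(n_1,\dots,n_r)$-entry $\delta\binom{p_1,\dots,p_{r-q}}{n_1,\dots,n_{r-q}}a_{n_{r-q+1},\dots,n_r}$. -}

module Defs where

open import Data.Nat as ℕ using (ℕ; zero; suc; _∸_; _%_; _≤_; _≟_)
open import Data.Nat.Properties as ℕP using (_≤?_)
open import Data.Rational using (ℚ; 0ℚ; 1ℚ; _+_; _*_; -_)
open import Data.Nat.ListAction using (sum)
open import Data.List using (List; []; _∷_; map; concatMap; filter; upTo; length; replicate; take; drop; zipWith; foldr; _++_; [_])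
open import Data.List.Properties using (≡-dec)
open import Data.List.Membership.Propositional using (_∈_)
open import Data.List.Relation.Unary.All using (All; all?)
open import Data.Product using (_×_; _,_)
open import Data.Bool using (if_then_else_)
open import Relation.Nullary using (does)
open import Relation.Nullary.Decidable using (_×-dec_)
open import Relation.Binary.PropositionalEquality using (_≡_)

Tuple : Set
Tuple = List ℕ

_≟T_ : (a b : Tuple) → _
_≟T_ = ≡-dec _≟_

δ : Tuple → Tuple → ℚ
δ a b = if does (a ≟T b) then 1ℚ else 0ℚ

Σ[_]_ : {A : Set} → List A → (A → ℚ) → ℚ
Σ[ xs ] f = foldr (λ x acc → f x + acc) 0ℚ xs

OddGe3 : ℕ → Set
OddGe3 x = (x % 2 ≡ 1) × (3 ≤ x)

InS : ℕ → Tuple → Set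
InS N n = (sum n ≡ N) × All OddGe3 n

InS? : (N : ℕ) → (n : Tuple) → _
InS? N n = (sum n ≟ N) ×-dec all? (λ x → ((x % 2) ≟ 1) ×-dec (3 ≤? x)) n

tuples : ℕ → ℕ → List Tuple
tuples N zero = [ [] ]
tuples N (suc r) = concatMap (λ a → map (a ∷_) (tuples N r)) (upTo (suc N))

S : ℕ → ℕ → List Tuple
S N r = filter (InS? N) (tuples N r)

-- Vect_{N,r}: rational vectors indexed by S_{N,r}, represented as functions
-- on tuples (only values on S_{N,r} matter); matrices likewise.

Vect : Set
Vect = Tuple → ℚ

Mat : Set
Mat = Tuple → Tuple → ℚ

ᵗ_ : Mat → Mat
(ᵗ M) m n = M n m

act : ℕ → ℕ → Vect → Mat → Vect
act N r v M n = Σ[ S N r ] (λ m → v m * M m n)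

_≈[_,_]_ : Vect → ℕ → ℕ → Vect → Set
u ≈[ N , r ] w = ∀ n → n ∈ S N r → u n ≡ w n

InKer : ℕ → ℕ → Mat → Vect → Set
InKer N r M v = ∀ n → n ∈ S N r → act N r v M n ≡ 0ℚ

-- Polynomials over ℚ in k variables: finite sums of terms c·x^e,
-- e an exponent list of length k.

Poly : Set
Poly = List (ℚ × List ℕ)

scale : ℚ → Poly → Poly
scale c = map (λ { (a , e) → (c * a , e) })

neg : Poly → Poly
neg = scale (- 1ℚ)

mul : Poly → Poly → Poly
mul f g = concatMap (λ { (a , e) → map (λ { (b , e') → (a * b , zipWith ℕ._+_ e e') }) g }) f

one : ℕ → Poly
one k = [ (1ℚ , replicate k 0) ]

pow : ℕ → Poly → ℕ → Poly
pow k f zero = one k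
pow k f (suc j) = mul f (pow k f j)

-- the variable x_j in k variables (1-indexed); x_0 = 0
var : ℕ → ℕ → Poly
var k zero = []
var k (suc j) = [ (1ℚ , replicate j 0 ++ (1 ∷ replicate (k ∸ suc j) 0)) ]

-- g(x_1,…,x̂_{i+1},…,x_{s+1}) : insert a zero exponent at (0-indexed) position i
omit : ℕ → Poly → Poly
omit i = map (λ { (a , e) → (a , take i e ++ (0 ∷ drop i e)) })

coeff : Poly → List ℕ → ℚ
coeff f e = Σ[ f ] (λ { (a , e') → if does (e' ≟T e) then a else 0ℚ })

signPow : ℕ → ℚ
signPow zero = 1ℚ
signPow (suc m) = - signPow m

-- x_1^{m-1} ∘ g  for g a polynomial in s variables
ucirc : ℕ → ℕ → Poly → Poly
ucirc m s g =
  concatMap (λ i → mul (pow k (var k (suc i) ++ neg (var k i)) (m ∸ 1)) (omit i g)) (upTo (suc s))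
  ++ scale (signPow m)
       (concatMap (λ i → mul (pow k (var k i ++ neg (var k (suc i))) (m ∸ 1)) (omit (i ∸ 1) g))
                  (map suc (upTo s)))
  where k = suc s

monomial : List ℕ → Poly
monomial e = [ (1ℚ , e) ]

ecoef : Tuple → Tuple → ℚ
ecoef [] ns = 0ℚ
ecoef (m ∷ ms) ns = coeff (ucirc m (length ms) (monomial (map (_∸ 1) ms))) (map (_∸ 1) ns)

E : Mat
E = ecoef

Eq : ℕ → ℕ → Mat
Eq q r m n = δ (take (r ∸ q) m) (take (r ∸ q) n) * ecoef (drop (r ∸ q) m) (drop (r ∸ q) n)

-- shuffle product of words (words = tuples of indices of the z's),
-- result as a list of words with multiplicity

shuffle : Tuple → Tuple → List Tuple
shuffle [] w = [ w ]
shuffle (a ∷ u) [] = [ a ∷ u ]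
shuffle (a ∷ u) (b ∷ w) = map (a ∷_) (shuffle u (b ∷ w)) ++ map (b ∷_) (shuffle (a ∷ u) w)

count : Tuple → List Tuple → ℚ
count n ws = Σ[ ws ] (λ w → δ w n)

-- Ψ_w : Vect_{N',r'} → Vect_{N'+P, r'+k},  v ↦ π₂⁻¹(π₂(v) ш w)
Ψ : ℕ → ℕ → Tuple → Vect → Vect
Ψ N' r' w v n = Σ[ S N' r' ] (λ m → v m * count n (shuffle m w))

Φ : Tuple → Vect → Vect
Φ ps a n = δ ps (take (length ps) n) * a (drop (length ps) n)

lincomb : List Tuple → (Tuple → ℚ) → (Tuple → Vect) → Vect
lincomb T c f n = Σ[ T ] (λ t → c t * f t n)

Odd : ℕ → Set
Odd p = p % 2 ≡ 1

Even : ℕ → Set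
Even p = p % 2 ≡ 0

{-# OPTIONS --safe #-}
-- For entries 1 + aᵢ, 1 + cᵢ with all aᵢ, cᵢ even, e has a closed form: x₁^a₁ ∘ (x₁^a₂ ⋯) is a signed sum of
-- powers (xᵢ₊₁ − xᵢ)^a₁ times monomials, so e(1+a ; 1+c) is δ(a, c) plus binomials binom a₁ cᵢ guarded by Kronecker
-- deltas, the signs being +1 by parity. Summing these closed forms over the shuffles m′ ш q (or m′ ш r₁r₂) almost
-- everything cancels: what survives is δ(q, n₁) δ(n₂⋯, m′), i.e. the matrix of Φ_q, plus multiples of
-- e(n with some entries deleted ; m′), which die against v ∈ ker ᵗE. This gives Ψ_p(v)·ᵗE = Φ_p(v), and for two
-- letters Ψ_{p₁p₂}(v)·ᵗE = Σ_t e(t ; p₁p₂) Φ_{t₁}(Ψ_{t₂}(v)) modulo the kernel. Since ᵗE^{(q)} acts as ᵗE on the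
-- slots after a fixed prefix, applying ᵗE^{(3)} reduces the latter to the first identity one level down, and the
-- kernel statements follow because Φ places v exactly in those slots.

module Submission where

open import Defs
open import Level using (0ℓ)
open import Data.Nat as ℕ using (ℕ; zero; suc; _∸_; _≤_; _<_; z≤n; s≤s; _≤ᵇ_; compare; less; equal; greater)
import Data.Nat.Properties as ℕP
open import Data.Nat.ListAction using (sum)
open import Data.Nat.ListAction.Properties using (sum-++)
open import Data.Rational as Q using (ℚ; 0ℚ; 1ℚ; _+_; _*_; -_)
import Data.Rational.Properties as QP
open import Data.List as L using (List; []; _∷_; map; concatMap; filter; upTo; length; take; drop; _++_; [_]; applyUpTo; zipWith)
import Data.List.Properties as LP
open import Data.List.Membership.Propositional using (_∈_)
open import Data.List.Membership.Propositional.Properties using (∈-filter⁻; ∈-filter⁺; ∈-map⁻; ∈-concat⁻′; ∈-map⁺; ∈-concat⁺′; ∈-upTo⁺)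
open import Data.List.Relation.Unary.Any using (here; there)
open import Data.List.Relation.Unary.All as All using (All; []; _∷_)
import Data.List.Relation.Unary.All.Properties as AllP
open import Data.Bool using (Bool; true; false; if_then_else_; _∧_)
open import Data.Product using (_×_; _,_; proj₁; proj₂)
open import Data.Unit using (⊤; tt)
open import Data.Sum using (_⊎_; inj₁; inj₂)
open import Data.Empty using (⊥; ⊥-elim)
open import Function using (_∘_)
open import Relation.Nullary using (does; yes; no; Dec; ¬_)
open import Relation.Nullary.Decidable using (dec⇒maybe)
open import Relation.Binary.PropositionalEquality hiding ([_])
open import Tactic.RingSolver.Core.AlmostCommutativeRing using (AlmostCommutativeRing; fromCommutativeRing)
open import Tactic.RingSolver using (solve-∀)
import Data.Nat.Tactic.RingSolver as NS

ℚ-ring : AlmostCommutativeRing 0ℓ 0ℓ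
ℚ-ring = fromCommutativeRing QP.+-*-commutativeRing (λ x → dec⇒maybe (0ℚ QP.≟ x))

𝟙 : Bool → ℚ
𝟙 b = if b then 1ℚ else 0ℚ

δℕ : ℕ → ℕ → ℚ
δℕ x y = 𝟙 (does (x ℕ.≟ y))

𝟙-∧ : ∀ a b → 𝟙 (a ∧ b) ≡ 𝟙 a * 𝟙 b
𝟙-∧ false b = sym (QP.*-zeroˡ (𝟙 b))
𝟙-∧ true b = sym (QP.*-identityˡ (𝟙 b))

𝟙-yes : {P : Set} (d : Dec P) → P → 𝟙 (does d) ≡ 1ℚ
𝟙-yes (yes _) _ = refl
𝟙-yes (no ¬p) p = ⊥-elim (¬p p)

𝟙-no : {P : Set} (d : Dec P) → ¬ P → 𝟙 (does d) ≡ 0ℚ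
𝟙-no (yes p) ¬p = ⊥-elim (¬p p)
𝟙-no (no _) _ = refl

𝟙-dec : {P : Set} (d : Dec P) → 𝟙 (does d) ≡ 0ℚ ⊎ (P × 𝟙 (does d) ≡ 1ℚ)
𝟙-dec (yes p) = inj₂ (p , refl)
𝟙-dec (no _) = inj₁ refl

0ℚ≢1ℚ : 0ℚ ≢ 1ℚ
0ℚ≢1ℚ ()

*≡0ˡ : ∀ (i a : ℚ) → i ≡ 0ℚ → i * a ≡ 0ℚ
*≡0ˡ i a refl = QP.*-zeroˡ a

*≡0ʳ : ∀ (i a : ℚ) → a ≡ 0ℚ → i * a ≡ 0ℚ
*≡0ʳ i a refl = QP.*-zeroʳ i

≡0⇒≡ : ∀ {p q : ℚ} → p ≡ 0ℚ → q ≡ 0ℚ → p ≡ q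
≡0⇒≡ p≡0 q≡0 = trans p≡0 (sym q≡0)

δℕ-sym : ∀ x y → δℕ x y ≡ δℕ y x
δℕ-sym zero zero = refl
δℕ-sym zero (suc y) = refl
δℕ-sym (suc x) zero = refl
δℕ-sym (suc x) (suc y) = δℕ-sym x y

δℕ-≡ : ∀ x y → x ≡ y → δℕ x y ≡ 1ℚ
δℕ-≡ x y = 𝟙-yes (x ℕ.≟ y)

δℕ-≢ : ∀ x y → x ≢ y → δℕ x y ≡ 0ℚ
δℕ-≢ x y = 𝟙-no (x ℕ.≟ y)

δ-∷ : ∀ x y xs ys → δ (x ∷ xs) (y ∷ ys) ≡ δℕ x y * δ xs ys
δ-∷ x y xs ys = 𝟙-∧ (does (x ℕ.≟ y)) (does (xs ≟T ys))

δ-≢ : ∀ xs ys → xs ≢ ys → δ xs ys ≡ 0ℚ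
δ-≢ xs ys = 𝟙-no (xs ≟T ys)

δ-sym : ∀ xs ys → δ xs ys ≡ δ ys xs
δ-sym xs ys with xs ≟T ys | ys ≟T xs
... | yes _ | yes _ = refl
... | no _ | no _ = refl
... | yes e | no ne = ⊥-elim (ne (sym e))
... | no ne | yes e = ⊥-elim (ne (sym e))

δ-subst : ∀ xs ys (g : Tuple → ℚ) → δ xs ys * g xs ≡ δ xs ys * g ys
δ-subst xs ys g with xs ≟T ys
... | yes refl = refl
... | no _ = trans (QP.*-zeroˡ (g xs)) (sym (QP.*-zeroˡ (g ys)))

Σ-cong : {A : Set} (xs : List A) {f g : A → ℚ} → (∀ x → x ∈ xs → f x ≡ g x) → Σ[ xs ] f ≡ Σ[ xs ] g
Σ-cong [] h = refl
Σ-cong (x ∷ xs) h = cong₂ _+_ (h x (here refl)) (Σ-cong xs (λ y y∈ → h y (there y∈)))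

Σ-0 : {A : Set} (xs : List A) → Σ[ xs ] (λ _ → 0ℚ) ≡ 0ℚ
Σ-0 [] = refl
Σ-0 (x ∷ xs) = trans (QP.+-identityˡ _) (Σ-0 xs)

Σ-+ : {A : Set} (xs : List A) (f g : A → ℚ) → Σ[ xs ] (λ x → f x + g x) ≡ Σ[ xs ] f + Σ[ xs ] g
Σ-+ [] f g = refl
Σ-+ (x ∷ xs) f g = trans (cong ((f x + g x) +_) (Σ-+ xs f g)) (interchange (f x) (g x) _ _)
  where
  interchange : ∀ a b c d → (a + b) + (c + d) ≡ (a + c) + (b + d)
  interchange = solve-∀ ℚ-ring

Σ-*ˡ : {A : Set} (xs : List A) (c : ℚ) (f : A → ℚ) → Σ[ xs ] (λ x → c * f x) ≡ c * Σ[ xs ] f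
Σ-*ˡ [] c f = sym (QP.*-zeroʳ c)
Σ-*ˡ (x ∷ xs) c f = trans (cong (c * f x +_) (Σ-*ˡ xs c f)) (sym (QP.*-distribˡ-+ c (f x) _))

Σ-*ʳ : {A : Set} (xs : List A) (c : ℚ) (f : A → ℚ) → Σ[ xs ] (λ x → f x * c) ≡ Σ[ xs ] f * c
Σ-*ʳ xs c f = trans (Σ-cong xs (λ x _ → QP.*-comm (f x) c)) (trans (Σ-*ˡ xs c f) (QP.*-comm c _))

Σ-++ : {A : Set} (xs ys : List A) (f : A → ℚ) → Σ[ xs ++ ys ] f ≡ Σ[ xs ] f + Σ[ ys ] f
Σ-++ [] ys f = sym (QP.+-identityˡ _)
Σ-++ (x ∷ xs) ys f = trans (cong (f x +_) (Σ-++ xs ys f)) (sym (QP.+-assoc (f x) _ _))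

Σ-concatMap : {A B : Set} (g : A → List B) (xs : List A) (f : B → ℚ) →
  Σ[ concatMap g xs ] f ≡ Σ[ xs ] (λ x → Σ[ g x ] f)
Σ-concatMap g [] f = refl
Σ-concatMap g (x ∷ xs) f = trans (Σ-++ (g x) (concatMap g xs) f) (cong (Σ[ g x ] f +_) (Σ-concatMap g xs f))

Σ-map : {A B : Set} (g : A → B) (xs : List A) (f : B → ℚ) → Σ[ map g xs ] f ≡ Σ[ xs ] (λ x → f (g x))
Σ-map g [] f = refl
Σ-map g (x ∷ xs) f = cong (f (g x) +_) (Σ-map g xs f)

Σ-swap : {A B : Set} (xs : List A) (ys : List B) (f : A → B → ℚ) →
  Σ[ xs ] (λ x → Σ[ ys ] (f x)) ≡ Σ[ ys ] (λ y → Σ[ xs ] (λ x → f x y))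
Σ-swap [] ys f = sym (Σ-0 ys)
Σ-swap (x ∷ xs) ys f = trans (cong (Σ[ ys ] (f x) +_) (Σ-swap xs ys f))
  (sym (Σ-+ ys (f x) (λ y → Σ[ xs ] (λ x → f x y))))

Σ-filter : {A : Set} {P : A → Set} (P? : ∀ x → Dec (P x)) (xs : List A) (f : A → ℚ) →
  Σ[ filter P? xs ] f ≡ Σ[ xs ] (λ x → 𝟙 (does (P? x)) * f x)
Σ-filter P? [] f = refl
Σ-filter P? (x ∷ xs) f with does (P? x)
... | true = cong₂ _+_ (sym (QP.*-identityˡ (f x))) (Σ-filter P? xs f)
... | false = trans (Σ-filter P? xs f) (sym (trans (cong (_+ _) (QP.*-zeroˡ (f x))) (QP.+-identityˡ _)))

Σ-*-distrib₄ : ∀ {A : Set} (xs : List A) (v a b c d : A → ℚ) →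
  Σ[ xs ] (λ x → v x * (a x + (b x + (c x + d x)))) ≡ Σ[ xs ] (λ x → v x * a x) + (Σ[ xs ] (λ x → v x * b x) + (Σ[ xs ] (λ x → v x * c x) + Σ[ xs ] (λ x → v x * d x)))
Σ-*-distrib₄ xs v a b c d = trans (Σ-cong xs (λ x _ → dist (v x) (a x) (b x) (c x) (d x)))
  (trans (Σ-+ xs (λ x → v x * a x) (λ x → v x * b x + (v x * c x + v x * d x)))
    (cong (Σ[ xs ] (λ x → v x * a x) +_) (trans (Σ-+ xs (λ x → v x * b x) (λ x → v x * c x + v x * d x))
      (cong (Σ[ xs ] (λ x → v x * b x) +_) (Σ-+ xs (λ x → v x * c x) (λ x → v x * d x))))))
  where dist : ∀ v a b c d → v * (a + (b + (c + d))) ≡ v * a + (v * b + (v * c + v * d))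
        dist = solve-∀ ℚ-ring

Σ-*-distrib₃ : ∀ {A : Set} (xs : List A) (v a b c : A → ℚ) →
  Σ[ xs ] (λ x → v x * (a x + (b x + c x))) ≡ Σ[ xs ] (λ x → v x * a x) + (Σ[ xs ] (λ x → v x * b x) + Σ[ xs ] (λ x → v x * c x))
Σ-*-distrib₃ xs v a b c = trans (Σ-cong xs (λ x _ → dist (v x) (a x) (b x) (c x)))
  (trans (Σ-+ xs (λ x → v x * a x) (λ x → v x * b x + v x * c x)) (cong (Σ[ xs ] (λ x → v x * a x) +_) (Σ-+ xs (λ x → v x * b x) (λ x → v x * c x))))
  where dist : ∀ v a b c → v * (a + (b + c)) ≡ v * a + (v * b + v * c)
        dist = solve-∀ ℚ-ring

Σ-linear₃ : ∀ {A : Set} (xs : List A) (a b c : ℚ) (f g h : A → ℚ) →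
  Σ[ xs ] (λ x → a * f x + (b * g x + c * h x)) ≡ a * Σ[ xs ] f + (b * Σ[ xs ] g + c * Σ[ xs ] h)
Σ-linear₃ xs a b c f g h = trans (Σ-+ xs (λ x → a * f x) (λ x → b * g x + c * h x))
  (cong₂ _+_ (Σ-*ˡ xs a f) (trans (Σ-+ xs (λ x → b * g x) (λ x → c * h x)) (cong₂ _+_ (Σ-*ˡ xs b g) (Σ-*ˡ xs c h))))

Σ-*-pull : ∀ {A : Set} (xs : List A) (v e : A → ℚ) (c : ℚ) → Σ[ xs ] (λ x → v x * (c * e x)) ≡ c * Σ[ xs ] (λ x → v x * e x)
Σ-*-pull xs v e c = trans (Σ-cong xs (λ x _ → swap (v x) c (e x))) (Σ-*ˡ xs c _)
  where swap : ∀ v c e → v * (c * e) ≡ c * (v * e)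
        swap = solve-∀ ℚ-ring

Σ-*-pull₂ : ∀ {A : Set} (xs : List A) (v e : A → ℚ) (a b : ℚ) → Σ[ xs ] (λ x → v x * (a * (b * e x))) ≡ a * (b * Σ[ xs ] (λ x → v x * e x))
Σ-*-pull₂ xs v e a b = trans (Σ-cong xs (λ x _ → swap (v x) a b (e x))) (trans (Σ-*ˡ xs a _) (cong (a *_) (Σ-*ˡ xs b _)))
  where swap : ∀ v a b e → v * (a * (b * e)) ≡ a * (b * (v * e))
        swap = solve-∀ ℚ-ring

sumN : ℕ → (ℕ → ℚ) → ℚ
sumN zero G = 0ℚ
sumN (suc M) G = G 0 + sumN M (G ∘ suc)

Σ-applyUpTo : ∀ M (f : ℕ → ℕ) (F : ℕ → ℚ) → Σ[ applyUpTo f M ] F ≡ sumN M (F ∘ f)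
Σ-applyUpTo zero f F = refl
Σ-applyUpTo (suc M) f F = cong (F (f 0) +_) (Σ-applyUpTo M (f ∘ suc) F)

sumN-0* : ∀ M (G : ℕ → ℚ) → sumN M (λ a → 0ℚ * G a) ≡ 0ℚ
sumN-0* zero G = refl
sumN-0* (suc M) G = cong₂ _+_ (QP.*-zeroˡ (G 0)) (sumN-0* M (G ∘ suc))

sumN-δℕ : ∀ M y (g : ℕ → ℚ) → y < M → sumN M (λ a → δℕ y a * g a) ≡ g y
sumN-δℕ (suc M) zero g _ =
  trans (cong₂ _+_ (QP.*-identityˡ (g 0)) (sumN-0* M (g ∘ suc))) (QP.+-identityʳ (g 0))
sumN-δℕ (suc M) (suc y) g (s≤s y<M) =
  trans (cong₂ _+_ (QP.*-zeroˡ (g 0)) (sumN-δℕ M y (g ∘ suc) y<M)) (QP.+-identityˡ _)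

Σ-upTo-δℕ : ∀ M y (g : ℕ → ℚ) → y < M → Σ[ upTo M ] (λ a → δℕ y a * g a) ≡ g y
Σ-upTo-δℕ M y g y<M = trans (Σ-applyUpTo M (λ x → x) _) (sumN-δℕ M y g y<M)

Σ-tuples-δ : ∀ N r (y : Tuple) → length y ≡ r → All (_≤ N) y → (h : Tuple → ℚ) →
  Σ[ tuples N r ] (λ x → δ y x * h x) ≡ h y
Σ-tuples-δ N zero [] refl _ h = trans (QP.+-identityʳ _) (QP.*-identityˡ (h []))
Σ-tuples-δ N (suc r) (y ∷ ys) refl (y≤N ∷ ys≤N) h = begin
  Σ[ tuples N (suc r) ] (λ x → δ (y ∷ ys) x * h x)
    ≡⟨ Σ-concatMap (λ a → map (a ∷_) (tuples N r)) (upTo (suc N)) (λ x → δ (y ∷ ys) x * h x) ⟩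
  Σ[ upTo (suc N) ] (λ a → Σ[ map (a ∷_) (tuples N r) ] (λ x → δ (y ∷ ys) x * h x))
    ≡⟨ Σ-cong (upTo (suc N)) (λ a _ → head-factor a) ⟩
  Σ[ upTo (suc N) ] (λ a → δℕ y a * Σ[ tuples N r ] (λ t → δ ys t * h (a ∷ t)))
    ≡⟨ Σ-cong (upTo (suc N)) (λ a _ → cong (δℕ y a *_) (Σ-tuples-δ N r ys refl ys≤N (λ t → h (a ∷ t)))) ⟩
  Σ[ upTo (suc N) ] (λ a → δℕ y a * h (a ∷ ys))
    ≡⟨ Σ-upTo-δℕ (suc N) y (λ a → h (a ∷ ys)) (s≤s y≤N) ⟩
  h (y ∷ ys) ∎
  where
  open ≡-Reasoning
  head-factor : ∀ a → Σ[ map (a ∷_) (tuples N r) ] (λ x → δ (y ∷ ys) x * h x)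
                    ≡ δℕ y a * Σ[ tuples N r ] (λ t → δ ys t * h (a ∷ t))
  head-factor a = trans (Σ-map (a ∷_) (tuples N r) (λ x → δ (y ∷ ys) x * h x))
    (trans (Σ-cong (tuples N r) (λ t _ → trans (cong (_* h (a ∷ t)) (δ-∷ y a ys t))
                                               (QP.*-assoc (δℕ y a) (δ ys t) (h (a ∷ t)))))
           (Σ-*ˡ (tuples N r) (δℕ y a) (λ t → δ ys t * h (a ∷ t))))

all≤sum : (y : Tuple) → All (_≤ sum y) y
all≤sum [] = []
all≤sum (x ∷ xs) = ℕP.m≤m+n x (sum xs) ∷ All.map (λ z≤ → ℕP.≤-trans z≤ (ℕP.m≤n+m (sum xs) x)) (all≤sum xs)

IsS : ℕ → ℕ → Tuple → Set
IsS N r y = (length y ≡ r) × InS N y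

IsS⇒All≤ : ∀ {N r y} → IsS N r y → All (_≤ N) y
IsS⇒All≤ {y = y} (_ , refl , _) = all≤sum y

∈-tuples : ∀ N r (y : Tuple) → length y ≡ r → All (_≤ N) y → y ∈ tuples N r
∈-tuples N zero [] refl [] = here refl
∈-tuples N (suc r) (y ∷ ys) refl (y≤ ∷ ys≤) =
  ∈-concat⁺′ (∈-map⁺ (y ∷_) (∈-tuples N r ys refl ys≤))
             (∈-map⁺ (λ a → map (a ∷_) (tuples N r)) (∈-upTo⁺ (s≤s y≤)))

∈-tuples⇒length : ∀ N r x → x ∈ tuples N r → length x ≡ r
∈-tuples⇒length N zero .[] (here refl) = refl
∈-tuples⇒length N (suc r) x x∈ with ∈-concat⁻′ (map (λ a → map (a ∷_) (tuples N r)) (upTo (suc N))) x∈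
... | xs , x∈xs , xs∈ with ∈-map⁻ (λ a → map (a ∷_) (tuples N r)) xs∈
... | a , _ , refl with ∈-map⁻ (a ∷_) x∈xs
... | t , t∈ , refl = cong suc (∈-tuples⇒length N r t t∈)

IsS⇒∈S : ∀ N r y → IsS N r y → y ∈ S N r
IsS⇒∈S N r y isS@(ly , iy) = ∈-filter⁺ (InS? N) (∈-tuples N r y ly (IsS⇒All≤ isS)) iy

∈S⇒IsS : ∀ N r x → x ∈ S N r → IsS N r x
∈S⇒IsS N r x x∈ with ∈-filter⁻ (InS? N) {xs = tuples N r} x∈
... | x∈tuples , p = ∈-tuples⇒length N r x x∈tuples , p

shuffle-All : ∀ {P : ℕ → Set} (u w : Tuple) → All P u → All P w → All (All P) (shuffle u w)
shuffle-All [] w pu shuffle-identity = shuffle-identity ∷ []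
shuffle-All (a ∷ u) [] pu shuffle-identity = pu ∷ []
shuffle-All (a ∷ u) (b ∷ w) (pa ∷ pu) (pb ∷ shuffle-identity) =
  AllP.++⁺ (AllP.map⁺ (All.map (pa ∷_) (shuffle-All u (b ∷ w) pu (pb ∷ shuffle-identity))))
           (AllP.map⁺ (All.map (pb ∷_) (shuffle-All (a ∷ u) w (pa ∷ pu) shuffle-identity)))

shuffle-length : ∀ (u w : Tuple) → All (λ x → length x ≡ length u ℕ.+ length w) (shuffle u w)
shuffle-length [] w = refl ∷ []
shuffle-length (a ∷ u) [] = cong suc (sym (ℕP.+-identityʳ _)) ∷ []
shuffle-length (a ∷ u) (b ∷ w) =
  AllP.++⁺ (AllP.map⁺ (All.map (cong suc) (shuffle-length u (b ∷ w))))
           (AllP.map⁺ (All.map (λ e → trans (cong suc e) (sym (ℕP.+-suc (suc (length u)) (length w)))) (shuffle-length (a ∷ u) w)))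

shuffle-sum : ∀ (u w : Tuple) → All (λ x → sum x ≡ sum u ℕ.+ sum w) (shuffle u w)
shuffle-sum [] w = refl ∷ []
shuffle-sum (a ∷ u) [] = sym (ℕP.+-identityʳ _) ∷ []
shuffle-sum (a ∷ u) (b ∷ w) =
  AllP.++⁺ (AllP.map⁺ (All.map (λ e → trans (cong (a ℕ.+_) e) (sym (ℕP.+-assoc a (sum u) _))) (shuffle-sum u (b ∷ w))))
           (AllP.map⁺ (All.map (λ e → trans (cong (b ℕ.+_) e) (exchange b (a ℕ.+ sum u) (sum w))) (shuffle-sum (a ∷ u) w)))
  where exchange : ∀ b s t → b ℕ.+ (s ℕ.+ t) ≡ s ℕ.+ (b ℕ.+ t)
        exchange = NS.solve-∀

shuffle-IsS : ∀ M r P k N (u w : Tuple) → IsS M r u → IsS P k w → M ℕ.+ P ≡ N → All (IsS N (r ℕ.+ k)) (shuffle u w)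
shuffle-IsS M r P k N u w (lu , su , ou) (lw , sw , ow) e = at (shuffle u w) (shuffle-length u w) (shuffle-sum u w) (shuffle-All u w ou ow)
  where
  at : ∀ xs → All (λ x → length x ≡ length u ℕ.+ length w) xs → All (λ x → sum x ≡ sum u ℕ.+ sum w) xs → All (All OddGe3) xs → All (IsS N (r ℕ.+ k)) xs
  at [] [] [] [] = []
  at (x ∷ xs) (l ∷ ls) (s ∷ ss) (o ∷ os) = (trans l (cong₂ ℕ._+_ lu lw) , trans s (trans (cong₂ ℕ._+_ su sw) e) , o) ∷ at xs ls ss os

IsS-singleton : ∀ p → OddGe3 p → IsS p 1 (p ∷ [])
IsS-singleton p odd = refl , ℕP.+-identityʳ p , odd ∷ []

length-insert : ∀ {y : ℕ} xs ys → length (xs ++ y ∷ ys) ≡ suc (length (xs ++ ys))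
length-insert [] ys = refl
length-insert (x ∷ xs) ys = cong suc (length-insert xs ys)

sum-insert : ∀ {y} xs ys → sum (xs ++ y ∷ ys) ≡ y ℕ.+ sum (xs ++ ys)
sum-insert [] ys = refl
sum-insert {y} (x ∷ xs) ys = trans (cong (x ℕ.+_) (sum-insert xs ys)) (exchange x y (sum (xs ++ ys)))
  where
  exchange : ∀ a b c → a ℕ.+ (b ℕ.+ c) ≡ b ℕ.+ (a ℕ.+ c)
  exchange = NS.solve-∀

All-delete : ∀ {P : ℕ → Set} xs {y ys} → All P (xs ++ y ∷ ys) → All P (xs ++ ys)
All-delete [] (_ ∷ ps) = ps
All-delete (x ∷ xs) (p ∷ ps) = p ∷ All-delete xs ps

m+n≡o⇒m≡o∸n : ∀ m n o → m ℕ.+ n ≡ o → m ≡ o ∸ n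
m+n≡o⇒m≡o∸n m n o e = trans (sym (ℕP.m+n∸n≡m m n)) (cong (_∸ n) e)

IsS-delete : ∀ {N r} xs y ys {p} → y ≡ p → IsS N (suc r) (xs ++ y ∷ ys) → IsS (N ∸ p) r (xs ++ ys)
IsS-delete xs y ys refl (len , total , odd) =
  ℕP.suc-injective (trans (sym (length-insert xs ys)) len) ,
  m+n≡o⇒m≡o∸n (sum (xs ++ ys)) y _ (trans (ℕP.+-comm (sum (xs ++ ys)) y) (trans (sym (sum-insert xs ys)) total)) ,
  All-delete xs odd

IsS-∸-pair : ∀ {N r xs} a b p → a ℕ.+ (b ℕ.+ 0) ≡ p → IsS (N ∸ a ∸ b) r xs → IsS (N ∸ p) r xs
IsS-∸-pair {N} {r} {xs} a b p refl = subst (λ K → IsS K r xs) (trans (ℕP.∸-+-assoc N a b) (cong (λ k → N ∸ (a ℕ.+ k)) (sym (ℕP.+-identityʳ b))))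

IsS-drop₂ : ∀ N p n t → IsS N 4 n → sum t ≡ p → take 2 n ≡ t → IsS (N ∸ p) 2 (drop 2 n)
IsS-drop₂ N .(x1 ℕ.+ (x2 ℕ.+ 0)) (x1 ∷ x2 ∷ x3 ∷ x4 ∷ []) .(x1 ∷ x2 ∷ []) isn@(refl , _) refl refl =
  IsS-∸-pair x1 x2 (x1 ℕ.+ (x2 ℕ.+ 0)) refl (IsS-delete [] x2 (x3 ∷ x4 ∷ []) refl (IsS-delete [] x1 (x2 ∷ x3 ∷ x4 ∷ []) refl isn))

IsS-∸⇒≤ : ∀ N p r (m : Tuple) → IsS (N ∸ p) (suc r) m → p ≤ N
IsS-∸⇒≤ N p r (x ∷ m) (_ , total , (_ , x≥3) ∷ _) = ℕP.<⇒≤ (ℕP.m∸n≢0⇒n<m N∸p≢0)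
  where
  N∸p≢0 : N ∸ p ≢ 0
  N∸p≢0 e with subst (3 ≤_) (trans total e) (ℕP.≤-trans x≥3 (ℕP.m≤m+n x (sum m)))
  ... | ()

Σ-S-δ : ∀ N r (y : Tuple) → IsS N r y → (h : Tuple → ℚ) → Σ[ S N r ] (λ x → δ y x * h x) ≡ h y
Σ-S-δ N r y isS@(ly , iy) h = begin
  Σ[ S N r ] (λ x → δ y x * h x)
    ≡⟨ Σ-filter (InS? N) (tuples N r) (λ x → δ y x * h x) ⟩
  Σ[ tuples N r ] (λ x → 𝟙 (does (InS? N x)) * (δ y x * h x))
    ≡⟨ Σ-cong (tuples N r) (λ x _ → move-indicator x) ⟩
  Σ[ tuples N r ] (λ x → δ y x * (𝟙 (does (InS? N y)) * h y))
    ≡⟨ Σ-tuples-δ N r y ly (IsS⇒All≤ isS) (λ _ → 𝟙 (does (InS? N y)) * h y) ⟩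
  𝟙 (does (InS? N y)) * h y
    ≡⟨ cong (_* h y) (𝟙-yes (InS? N y) iy) ⟩
  1ℚ * h y
    ≡⟨ QP.*-identityˡ (h y) ⟩
  h y ∎
  where
  open ≡-Reasoning
  swap : ∀ a b c → a * (b * c) ≡ b * (a * c)
  swap = solve-∀ ℚ-ring
  move-indicator : ∀ x → 𝟙 (does (InS? N x)) * (δ y x * h x) ≡ δ y x * (𝟙 (does (InS? N y)) * h y)
  move-indicator x = trans (swap (𝟙 (does (InS? N x))) (δ y x) (h x)) (sym (δ-subst y x (λ z → 𝟙 (does (InS? N z)) * h z)))

Σ-S-δʳ : ∀ M r (d : Tuple) → IsS M r d → (v : Vect) → Σ[ S M r ] (λ x → v x * δ d x) ≡ v d
Σ-S-δʳ M r d isd v = trans (Σ-cong (S M r) (λ x _ → QP.*-comm (v x) (δ d x))) (Σ-S-δ M r d isd v)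

Σ-S-count : ∀ N r (ws : List Tuple) → All (IsS N r) ws → (f : Tuple → ℚ) →
  Σ[ S N r ] (λ m → count m ws * f m) ≡ Σ[ ws ] f
Σ-S-count N r ws all-S f = begin
  Σ[ S N r ] (λ m → count m ws * f m)
    ≡⟨ Σ-cong (S N r) (λ m _ → sym (Σ-*ʳ ws (f m) (λ w → δ w m))) ⟩
  Σ[ S N r ] (λ m → Σ[ ws ] (λ w → δ w m * f m))
    ≡⟨ Σ-swap (S N r) ws (λ m w → δ w m * f m) ⟩
  Σ[ ws ] (λ w → Σ[ S N r ] (λ m → δ w m * f m))
    ≡⟨ Σ-cong ws (λ w w∈ → Σ-S-δ N r w (All.lookup all-S w∈) f) ⟩
  Σ[ ws ] f ∎
  where open ≡-Reasoning

act-Ψ : ∀ N r M r' (w : Tuple) (v : Vect) (A : Mat) →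
  (∀ m' → m' ∈ S M r' → All (IsS N r) (shuffle m' w)) → ∀ n →
  act N r (Ψ M r' w v) A n ≡ Σ[ S M r' ] (λ m' → v m' * Σ[ shuffle m' w ] (λ w' → A w' n))
act-Ψ N r M r' w v A shuffles-in-S n = begin
  Σ[ S N r ] (λ m → Σ[ S M r' ] (λ m' → v m' * count m (shuffle m' w)) * A m n)
    ≡⟨ Σ-cong (S N r) (λ m _ → trans (sym (Σ-*ʳ (S M r') (A m n) (λ m' → v m' * count m (shuffle m' w))))
          (Σ-cong (S M r') (λ m' _ → QP.*-assoc (v m') (count m (shuffle m' w)) (A m n)))) ⟩
  Σ[ S N r ] (λ m → Σ[ S M r' ] (λ m' → v m' * (count m (shuffle m' w) * A m n)))
    ≡⟨ Σ-swap (S N r) (S M r') (λ m m' → v m' * (count m (shuffle m' w) * A m n)) ⟩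
  Σ[ S M r' ] (λ m' → Σ[ S N r ] (λ m → v m' * (count m (shuffle m' w) * A m n)))
    ≡⟨ Σ-cong (S M r') (λ m' m'∈ → trans (Σ-*ˡ (S N r) (v m') (λ m → count m (shuffle m' w) * A m n))
          (cong (v m' *_) (Σ-S-count N r (shuffle m' w) (shuffles-in-S m' m'∈) (λ w' → A w' n)))) ⟩
  Σ[ S M r' ] (λ m' → v m' * Σ[ shuffle m' w ] (λ w' → A w' n)) ∎
  where open ≡-Reasoning

δ-++ : ∀ k (ps a m : Tuple) → length ps ≡ k → δ (ps ++ a) m ≡ δ ps (take k m) * δ a (drop k m)
δ-++ .0 [] a m refl = sym (QP.*-identityˡ (δ a m))
δ-++ .(suc (length ps)) (x ∷ ps) a [] refl = sym (QP.*-zeroˡ (δ a []))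
δ-++ .(suc (length ps)) (x ∷ ps) a (y ∷ m) refl = begin
  δ (x ∷ ps ++ a) (y ∷ m)                                           ≡⟨ δ-∷ x y (ps ++ a) m ⟩
  δℕ x y * δ (ps ++ a) m                                            ≡⟨ cong (δℕ x y *_) (δ-++ (length ps) ps a m refl) ⟩
  δℕ x y * (δ ps (take (length ps) m) * δ a (drop (length ps) m))   ≡⟨ sym (QP.*-assoc (δℕ x y) _ _) ⟩
  (δℕ x y * δ ps (take (length ps) m)) * δ a (drop (length ps) m)   ≡⟨ cong (_* δ a (drop (length ps) m)) (sym (δ-∷ x y ps (take (length ps) m))) ⟩
  δ (x ∷ ps) (y ∷ take (length ps) m) * δ a (drop (length ps) m)    ∎
  where open ≡-Reasoning

drop-length-++ : ∀ (ps a : Tuple) → drop (length ps) (ps ++ a) ≡ a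
drop-length-++ [] a = refl
drop-length-++ (x ∷ ps) a = drop-length-++ ps a

sum-take-drop : ∀ k (m : Tuple) → sum (take k m) ℕ.+ sum (drop k m) ≡ sum m
sum-take-drop k m = trans (sym (sum-++ (take k m) (drop k m))) (cong sum (LP.take++drop≡id k m))

Σ-S-δ-prefix : ∀ N k r (ps : Tuple) → length ps ≡ k → All OddGe3 ps → (f : Tuple → ℚ) →
  Σ[ S N (k ℕ.+ suc r) ] (λ m → δ ps (take k m) * f (drop k m)) ≡ Σ[ S (N ∸ sum ps) (suc r) ] f
Σ-S-δ-prefix N k r ps lps ops f = sym (begin
  Σ[ S N' (suc r) ] f
    ≡⟨ Σ-cong (S N' (suc r)) (λ m' m'∈ → sym (trans (Σ-S-δ N (k ℕ.+ suc r) (ps ++ m') (prepend m' (∈S⇒IsS N' (suc r) m' m'∈)) (λ m → f (drop k m)))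
            (cong f (trans (cong (λ z → drop z (ps ++ m')) (sym lps)) (drop-length-++ ps m'))))) ⟩
  Σ[ S N' (suc r) ] (λ m' → Σ[ S N (k ℕ.+ suc r) ] (λ m → δ (ps ++ m') m * f (drop k m)))
    ≡⟨ Σ-swap (S N' (suc r)) (S N (k ℕ.+ suc r)) (λ m' m → δ (ps ++ m') m * f (drop k m)) ⟩
  Σ[ S N (k ℕ.+ suc r) ] (λ m → Σ[ S N' (suc r) ] (λ m' → δ (ps ++ m') m * f (drop k m)))
    ≡⟨ Σ-cong (S N (k ℕ.+ suc r)) (λ m m∈ → trans (Σ-*ʳ (S N' (suc r)) (f (drop k m)) (λ m' → δ (ps ++ m') m))
          (cong (_* f (drop k m)) (Σ-suffix m (∈S⇒IsS N (k ℕ.+ suc r) m m∈)))) ⟩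
  Σ[ S N (k ℕ.+ suc r) ] (λ m → δ ps (take k m) * f (drop k m)) ∎)
  where
  open ≡-Reasoning
  N' = N ∸ sum ps
  prepend : ∀ m' → IsS N' (suc r) m' → IsS N (k ℕ.+ suc r) (ps ++ m')
  prepend (x ∷ m'') (lm , sm , (ox , x≥3) ∷ om) =
    trans (LP.length-++ ps) (cong₂ ℕ._+_ lps lm) ,
    trans (sum-++ ps (x ∷ m'')) (trans (cong (sum ps ℕ.+_) sm) (ℕP.m+[n∸m]≡n (ℕP.<⇒≤ sum-ps<N))) ,
    AllP.++⁺ ops ((ox , x≥3) ∷ om)
    where
    N'≢0 : N' ≢ 0
    N'≢0 N'≡0 with subst (3 ≤_) (trans sm N'≡0) (ℕP.≤-trans x≥3 (ℕP.m≤m+n x (sum m'')))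
    ... | ()
    sum-ps<N : sum ps < N
    sum-ps<N = ℕP.m∸n≢0⇒n<m N'≢0
  Σ-suffix : ∀ m → IsS N (k ℕ.+ suc r) m → Σ[ S N' (suc r) ] (λ m' → δ (ps ++ m') m) ≡ δ ps (take k m)
  Σ-suffix m (lm , sm , om) = trans (Σ-cong (S N' (suc r)) (λ m' _ → δ-++ k ps m' m lps))
    (trans (Σ-*ˡ (S N' (suc r)) (δ ps (take k m)) (λ m' → δ m' (drop k m))) (by-cases (ps ≟T take k m)))
    where
    suffix-in-S : ps ≡ take k m → IsS N' (suc r) (drop k m)
    suffix-in-S e = trans (LP.length-drop k m) (trans (cong (_∸ k) lm) (ℕP.m+n∸m≡n k (suc r))) ,
           trans (sym (ℕP.m+n∸m≡n (sum (take k m)) (sum (drop k m))))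
                 (cong₂ _∸_ (trans (sum-take-drop k m) sm) (cong sum (sym e))) ,
           AllP.drop⁺ k om
    by-cases : Dec (ps ≡ take k m) → δ ps (take k m) * Σ[ S N' (suc r) ] (λ m' → δ m' (drop k m)) ≡ δ ps (take k m)
    by-cases (no ne) = trans (cong (_* Σ[ S N' (suc r) ] (λ m' → δ m' (drop k m))) (δ-≢ ps (take k m) ne))
      (trans (QP.*-zeroˡ (Σ[ S N' (suc r) ] (λ m' → δ m' (drop k m)))) (sym (δ-≢ ps (take k m) ne)))
    by-cases (yes e) = trans (cong (δ ps (take k m) *_)
        (trans (Σ-cong (S N' (suc r)) (λ m' _ → trans (δ-sym m' (drop k m)) (sym (QP.*-identityʳ _))))
               (Σ-S-δ N' (suc r) (drop k m) (suffix-in-S e) (λ _ → 1ℚ))))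
      (QP.*-identityʳ _)

-- The coefficient carried by terms negated with Defs.neg, which scales by - 1ℚ.
neg1 : ℚ
neg1 = - 1ℚ * 1ℚ

neg1* : ∀ z → neg1 * z ≡ - z
neg1* z = trans (sym (QP.neg-distribˡ-* 1ℚ z)) (cong -_ (QP.*-identityˡ z))

monoDiff : List ℕ → List ℕ → Poly
monoDiff u u' = (1ℚ , u) ∷ (neg1 , u') ∷ []

coeffShift : Poly → List ℕ → List ℕ → ℚ
coeffShift P e c = coeff (mul P (monomial e)) c

coeff-++ : ∀ P P' c → coeff (P ++ P') c ≡ coeff P c + coeff P' c
coeff-++ [] P' c = sym (QP.+-identityˡ _)
coeff-++ ((a , e) ∷ P) P' c = trans (cong ((if does (e ≟T c) then a else 0ℚ) +_) (coeff-++ P P' c))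
  (sym (QP.+-assoc (if does (e ≟T c) then a else 0ℚ) (coeff P c) (coeff P' c)))

if-*ˡ : ∀ b d a → (if b then d * a else 0ℚ) ≡ d * (if b then a else 0ℚ)
if-*ˡ true d a = refl
if-*ˡ false d a = sym (QP.*-zeroʳ d)

coeff-scale : ∀ d P c → coeff (scale d P) c ≡ d * coeff P c
coeff-scale d [] c = sym (QP.*-zeroʳ d)
coeff-scale d ((a , e) ∷ P) c = trans (cong₂ _+_ (if-*ˡ (does (e ≟T c)) d a) (coeff-scale d P c))
  (sym (QP.*-distribˡ-+ d (if does (e ≟T c) then a else 0ℚ) (coeff P c)))

mul-++ : ∀ A B R → mul (A ++ B) R ≡ mul A R ++ mul B R
mul-++ [] B R = refl
mul-++ (t ∷ A) B R = ++-prepend (mul-++ A B R)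
  where
  ++-prepend : ∀ {X Y Z W : Poly} → Y ≡ Z ++ W → X ++ Y ≡ (X ++ Z) ++ W
  ++-prepend {X} {Z = Z} {W} refl = sym (LP.++-assoc X Z W)

coeffShift-++ : ∀ A B e c → coeffShift (A ++ B) e c ≡ coeffShift A e c + coeffShift B e c
coeffShift-++ A B e c = trans (cong (λ P → coeff P c) (mul-++ A B (monomial e)))
  (coeff-++ (mul A (monomial e)) (mul B (monomial e)) c)

zipWith-+-exchange : ∀ (u x e : List ℕ) → zipWith ℕ._+_ (zipWith ℕ._+_ u x) e ≡ zipWith ℕ._+_ x (zipWith ℕ._+_ u e)
zipWith-+-exchange [] [] e = refl
zipWith-+-exchange [] (b ∷ x) e = refl
zipWith-+-exchange (a ∷ u) [] e = refl
zipWith-+-exchange (a ∷ u) (b ∷ x) [] = refl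
zipWith-+-exchange (a ∷ u) (b ∷ x) (c ∷ e) = cong₂ _∷_ (exchange a b c) (zipWith-+-exchange u x e)
  where
  exchange : ∀ a b c → (a ℕ.+ b) ℕ.+ c ≡ b ℕ.+ (a ℕ.+ c)
  exchange = NS.solve-∀

coeffShift-term : ∀ a u Q e c → coeffShift (mul [ (a , u) ] Q) e c ≡ a * coeffShift Q (zipWith ℕ._+_ u e) c
coeffShift-term a u [] e c = sym (QP.*-zeroʳ a)
coeffShift-term a u ((b , e') ∷ Q) e c rewrite zipWith-+-exchange u e' e =
  trans (cong₂ _+_ (trans (cong (λ z → if does (ue ≟T c) then z else 0ℚ) (QP.*-assoc a b 1ℚ)) (if-*ˡ (does (ue ≟T c)) a (b * 1ℚ)))
                   (coeffShift-term a u Q e c))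
    (sym (QP.*-distribˡ-+ a (if does (ue ≟T c) then b * 1ℚ else 0ℚ) (coeffShift Q (zipWith ℕ._+_ u e) c)))
  where ue = zipWith ℕ._+_ e' (zipWith ℕ._+_ u e)

coeffShift-mono : ∀ u Q e c → coeffShift (mul [ (1ℚ , u) ] Q) e c ≡ coeffShift Q (zipWith ℕ._+_ u e) c
coeffShift-mono u Q e c = trans (coeffShift-term 1ℚ u Q e c) (QP.*-identityˡ (coeffShift Q (zipWith ℕ._+_ u e) c))

coeffShift-monoDiff : ∀ u u' Q e c →
  coeffShift (mul (monoDiff u u') Q) e c ≡ coeffShift Q (zipWith ℕ._+_ u e) c + neg1 * coeffShift Q (zipWith ℕ._+_ u' e) c
coeffShift-monoDiff u u' Q e c =
  trans (cong (λ P → coeff (mul P (monomial e)) c) (mul-++ [ (1ℚ , u) ] [ (neg1 , u') ] Q))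
    (trans (coeffShift-++ (mul [ (1ℚ , u) ] Q) (mul [ (neg1 , u') ] Q) e c)
      (cong₂ _+_ (coeffShift-mono u Q e c) (coeffShift-term neg1 u' Q e c)))

binom : ℕ → ℕ → ℚ
binom zero zero = 1ℚ
binom zero (suc k) = 0ℚ
binom (suc n) zero = 1ℚ
binom (suc n) (suc k) = binom n k + binom n (suc k)

binom-n-0 : ∀ n → binom n 0 ≡ 1ℚ
binom-n-0 zero = refl
binom-n-0 (suc n) = refl

binom-n-1+n+k : ∀ n k → binom n (suc (n ℕ.+ k)) ≡ 0ℚ
binom-n-1+n+k zero k = refl
binom-n-1+n+k (suc n) k =
  trans (cong₂ _+_ (binom-n-1+n+k n k) (trans (cong (binom n) (cong suc (sym (ℕP.+-suc n k)))) (binom-n-1+n+k n (suc k))))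
        (QP.+-identityˡ 0ℚ)

-- The coefficient of x^cα y^cβ in (x - y)^j x^a y^b, without the degree condition a + b + j = cα + cβ.
signedBinom : ℕ → ℕ → ℕ → ℕ → ℕ → ℚ
signedBinom cα cβ j a b = if a ≤ᵇ cα then signPow (cβ ∸ b) * binom j (cα ∸ a) else 0ℚ

powDiffCoeff : ℕ → ℕ → ℕ → ℕ → ℕ → ℚ
powDiffCoeff cα cβ j a b = δℕ (a ℕ.+ b ℕ.+ j) (cα ℕ.+ cβ) * signedBinom cα cβ j a b

≤ᵇ-true : ∀ {m n} → m ≤ n → (m ≤ᵇ n) ≡ true
≤ᵇ-true {m} {n} m≤n with m ≤ᵇ n | ℕP.≤⇒≤ᵇ m≤n
... | true | _ = refl

≤ᵇ-false : ∀ {m n} → n < m → (m ≤ᵇ n) ≡ false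
≤ᵇ-false {m} {n} n<m with m ≤ᵇ n | ℕP.≤ᵇ⇒≤ m n
... | false | _ = refl
... | true | ≤ᵇ⇒≤ = ⊥-elim (ℕP.<⇒≱ n<m (≤ᵇ⇒≤ _))

if-true : ∀ {b} → b ≡ true → (p q : ℚ) → (if b then p else q) ≡ p
if-true refl p q = refl

if-false : ∀ {b} → b ≡ false → (p q : ℚ) → (if b then p else q) ≡ q
if-false refl p q = refl

[1+x+k]∸x : ∀ x k → suc (x ℕ.+ k) ∸ x ≡ suc k
[1+x+k]∸x x k = trans (cong (_∸ x) (sym (ℕP.+-suc x k))) (ℕP.m+n∸m≡n x (suc k))

powDiffCoeff-0 : ∀ cα cβ a b → powDiffCoeff cα cβ 0 a b ≡ δℕ a cα * δℕ b cβ
powDiffCoeff-0 cα cβ a b with compare a cα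
... | less .a k = ≡0⇒≡
  (*≡0ʳ (δℕ (a ℕ.+ b ℕ.+ 0) (suc (a ℕ.+ k) ℕ.+ cβ)) _
     (trans (if-true (≤ᵇ-true (ℕP.m≤n⇒m≤1+n (ℕP.m≤m+n a k))) (signPow (cβ ∸ b) * binom 0 (suc (a ℕ.+ k) ∸ a)) 0ℚ)
            (*≡0ʳ (signPow (cβ ∸ b)) _ (cong (binom 0) ([1+x+k]∸x a k)))))
  (*≡0ˡ _ (δℕ b cβ) (δℕ-≢ a (suc (a ℕ.+ k)) (ℕP.m≢1+m+n a)))
... | greater .cα k = ≡0⇒≡
  (*≡0ʳ (δℕ (suc (cα ℕ.+ k) ℕ.+ b ℕ.+ 0) (cα ℕ.+ cβ)) _
     (if-false (≤ᵇ-false (s≤s (ℕP.m≤m+n cα k))) (signPow (cβ ∸ b) * binom 0 (cα ∸ suc (cα ℕ.+ k))) 0ℚ))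
  (*≡0ˡ _ (δℕ b cβ) (δℕ-≢ (suc (cα ℕ.+ k)) cα (λ e → ℕP.m≢1+m+n cα (sym e))))
... | equal .a with b ℕ.≟ cβ
...   | yes refl = trans
  (cong₂ _*_ (δℕ-≡ (a ℕ.+ b ℕ.+ 0) (a ℕ.+ b) (ℕP.+-identityʳ _))
             (trans (if-true (≤ᵇ-true (ℕP.≤-refl {a})) (signPow (b ∸ b) * binom 0 (a ∸ a)) 0ℚ)
                    (cong₂ (λ i j → signPow i * binom 0 j) (ℕP.n∸n≡0 b) (ℕP.n∸n≡0 a))))
  (sym (cong₂ _*_ (δℕ-≡ a a refl) (δℕ-≡ b b refl)))
...   | no b≢cβ = ≡0⇒≡
  (*≡0ˡ _ (signedBinom a cβ 0 a b)
     (δℕ-≢ (a ℕ.+ b ℕ.+ 0) (a ℕ.+ cβ) (λ e → b≢cβ (ℕP.+-cancelˡ-≡ a b cβ (trans (sym (ℕP.+-identityʳ _)) e)))))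
  (*≡0ʳ (δℕ a a) _ (δℕ-≢ b cβ b≢cβ))

-- Pascal's rule for the expansion of (x - y)^(j+1) = (x - y)^j x - (x - y)^j y.
signedBinom-suc : ∀ cα cβ j a b → suc (a ℕ.+ b ℕ.+ j) ≡ cα ℕ.+ cβ →
  signedBinom cα cβ (suc j) a b ≡ signedBinom cα cβ j (suc a) b + neg1 * signedBinom cα cβ j a (suc b)
signedBinom-suc cα cβ j a b deg with compare a cα
... | greater .cα k =
  trans (if-false (≤ᵇ-false (s≤s (ℕP.m≤m+n cα k))) (signPow (cβ ∸ b) * binom (suc j) (cα ∸ suc (cα ℕ.+ k))) 0ℚ)
    (sym (trans (cong₂ _+_ (if-false (≤ᵇ-false (s≤s (ℕP.m≤n⇒m≤1+n (ℕP.m≤m+n cα k)))) (signPow (cβ ∸ b) * binom j (cα ∸ suc (suc (cα ℕ.+ k)))) 0ℚ)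
                           (*≡0ʳ neg1 _ (if-false (≤ᵇ-false (s≤s (ℕP.m≤m+n cα k))) (signPow (cβ ∸ suc b) * binom j (cα ∸ suc (cα ℕ.+ k))) 0ℚ)))
                (QP.+-identityˡ 0ℚ)))
... | equal .a = begin
  signedBinom a cβ (suc j) a b
    ≡⟨ if-true (≤ᵇ-true (ℕP.≤-refl {a})) (signPow (cβ ∸ b) * binom (suc j) (a ∸ a)) 0ℚ ⟩
  signPow (cβ ∸ b) * binom (suc j) (a ∸ a)
    ≡⟨ cong₂ (λ i j' → signPow i * binom (suc j) j') (trans (cong (_∸ b) cβ≡) ([1+x+k]∸x b j)) (ℕP.n∸n≡0 a) ⟩
  - signPow j * 1ℚ
    ≡⟨ trans (QP.*-identityʳ _) (sym (trans (QP.+-identityˡ _) (trans (neg1* _) (cong -_ (QP.*-identityʳ (signPow j)))))) ⟩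
  0ℚ + neg1 * (signPow j * 1ℚ)
    ≡⟨ sym (cong₂ _+_ (if-false (≤ᵇ-false (ℕP.≤-refl {suc a})) (signPow (cβ ∸ b) * binom j (a ∸ suc a)) 0ℚ)
                      (cong (neg1 *_) (trans (if-true (≤ᵇ-true (ℕP.≤-refl {a})) (signPow (cβ ∸ suc b) * binom j (a ∸ a)) 0ℚ)
                         (cong₂ (λ i z → signPow i * z) (trans (cong (_∸ suc b) cβ≡) (ℕP.m+n∸m≡n b j))
                                                       (trans (cong (binom j) (ℕP.n∸n≡0 a)) (binom-n-0 j)))))) ⟩
  signedBinom a cβ j (suc a) b + neg1 * signedBinom a cβ j a (suc b) ∎
  where
  open ≡-Reasoning
  cβ≡ : cβ ≡ suc (b ℕ.+ j)
  cβ≡ = sym (ℕP.+-cancelˡ-≡ a (suc (b ℕ.+ j)) cβ (trans (ℕP.+-suc a (b ℕ.+ j)) (trans (cong suc (sym (ℕP.+-assoc a b j))) deg)))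
... | less .a k = begin
  signedBinom cα' cβ (suc j) a b
    ≡⟨ trans (if-true a≤cα' (signPow (cβ ∸ b) * binom (suc j) (cα' ∸ a)) 0ℚ) (cong (λ z → signPow (cβ ∸ b) * binom (suc j) z) ([1+x+k]∸x a k)) ⟩
  signPow (cβ ∸ b) * (binom j k + binom j (suc k))
    ≡⟨ split-sign ⟩
  signPow (cβ ∸ b) * binom j k + neg1 * (signPow (cβ ∸ suc b) * binom j (suc k))
    ≡⟨ sym (cong₂ _+_
         (trans (if-true (≤ᵇ-true (s≤s (ℕP.m≤m+n a k))) (signPow (cβ ∸ b) * binom j (cα' ∸ suc a)) 0ℚ)
                (cong (λ z → signPow (cβ ∸ b) * binom j z) (ℕP.m+n∸m≡n a k)))
         (cong (neg1 *_) (trans (if-true a≤cα' (signPow (cβ ∸ suc b) * binom j (cα' ∸ a)) 0ℚ)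
                                (cong (λ z → signPow (cβ ∸ suc b) * binom j z) ([1+x+k]∸x a k))))) ⟩
  signedBinom cα' cβ j (suc a) b + neg1 * signedBinom cα' cβ j a (suc b) ∎
  where
  open ≡-Reasoning
  cα' = suc (a ℕ.+ k)
  a≤cα' : (a ≤ᵇ cα') ≡ true
  a≤cα' = ≤ᵇ-true (ℕP.m≤n⇒m≤1+n (ℕP.m≤m+n a k))
  b+j≡k+cβ : b ℕ.+ j ≡ k ℕ.+ cβ
  b+j≡k+cβ = ℕP.+-cancelˡ-≡ a (b ℕ.+ j) (k ℕ.+ cβ)
    (trans (sym (ℕP.+-assoc a b j)) (trans (ℕP.suc-injective deg) (ℕP.+-assoc a k cβ)))
  binom-vanishes : ∀ m → b ≡ cβ ℕ.+ m → binom j (suc k) ≡ 0ℚ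
  binom-vanishes m refl = trans (cong (λ z → binom j (suc z)) k≡j+m) (binom-n-1+n+k j m)
    where
    k≡j+m : k ≡ j ℕ.+ m
    k≡j+m = ℕP.+-cancelˡ-≡ cβ k (j ℕ.+ m) (trans (ℕP.+-comm cβ k) (trans (sym b+j≡k+cβ)
              (trans (ℕP.+-assoc cβ m j) (cong (cβ ℕ.+_) (ℕP.+-comm m j)))))
  vanishing-tail : ∀ s s' t z → z ≡ 0ℚ → s * (t + z) ≡ s * t + neg1 * (s' * z)
  vanishing-tail s s' t z refl = trans (cong (s *_) (QP.+-identityʳ t))
    (sym (trans (cong (s * t +_) (*≡0ʳ neg1 (s' * 0ℚ) (QP.*-zeroʳ s'))) (QP.+-identityʳ _)))
  split-sign : signPow (cβ ∸ b) * (binom j k + binom j (suc k)) ≡ signPow (cβ ∸ b) * binom j k + neg1 * (signPow (cβ ∸ suc b) * binom j (suc k))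
  split-sign with compare b cβ
  ... | less .b l = trans (cong (λ z → signPow z * (binom j k + binom j (suc k))) ([1+x+k]∸x b l))
      (trans (distrib (signPow l) (binom j k) (binom j (suc k)))
        (cong₂ (λ i i' → signPow i * binom j k + neg1 * (signPow i' * binom j (suc k))) (sym ([1+x+k]∸x b l)) (sym (ℕP.m+n∸m≡n b l))))
    where
    distrib : ∀ s t u → (- s) * (t + u) ≡ (- s) * t + neg1 * (s * u)
    distrib s t u = trans (neg-distrib s t u) (cong ((- s) * t +_) (sym (neg1* (s * u))))
      where
      neg-distrib : ∀ s t u → (- s) * (t + u) ≡ (- s) * t + - (s * u)
      neg-distrib = solve-∀ ℚ-ring
  ... | equal .b = vanishing-tail (signPow (cβ ∸ b)) (signPow (cβ ∸ suc b)) (binom j k) (binom j (suc k)) (binom-vanishes 0 (sym (ℕP.+-identityʳ b)))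
  ... | greater .cβ l = vanishing-tail (signPow (cβ ∸ b)) (signPow (cβ ∸ suc b)) (binom j k) (binom j (suc k)) (binom-vanishes (suc l) (sym (ℕP.+-suc cβ l)))

powDiffCoeff-suc : ∀ cα cβ j a b → powDiffCoeff cα cβ (suc j) a b ≡ powDiffCoeff cα cβ j (suc a) b + neg1 * powDiffCoeff cα cβ j a (suc b)
powDiffCoeff-suc cα cβ j a b rewrite ℕP.+-suc (a ℕ.+ b) j | ℕP.+-suc a b with 𝟙-dec (suc (a ℕ.+ b ℕ.+ j) ℕ.≟ (cα ℕ.+ cβ))
... | inj₁ i≡0 = scaled _ _ _ _ (inj₁ i≡0) (λ i≡1 → ⊥-elim (0ℚ≢1ℚ (trans (sym i≡0) i≡1)))
  where
  scaled : ∀ i t u w → (i ≡ 0ℚ ⊎ i ≡ 1ℚ) → (i ≡ 1ℚ → t ≡ u + neg1 * w) → i * t ≡ i * u + neg1 * (i * w)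
  scaled i t u w (inj₁ refl) _ = trans (QP.*-zeroˡ t) (sym (trans (cong₂ _+_ (QP.*-zeroˡ u) (*≡0ʳ neg1 (0ℚ * w) (QP.*-zeroˡ w))) (QP.+-identityʳ 0ℚ)))
  scaled i t u w (inj₂ refl) h = trans (QP.*-identityˡ t) (trans (h refl) (sym (cong₂ (λ p q → p + neg1 * q) (QP.*-identityˡ u) (QP.*-identityˡ w))))
... | inj₂ (deg , i≡1) = trans (cong (_* signedBinom cα cβ (suc j) a b) i≡1)
  (trans (QP.*-identityˡ (signedBinom cα cβ (suc j) a b))
    (trans (signedBinom-suc cα cβ j a b deg)
      (sym (cong₂ (λ p q → p + neg1 * q) (one* (signedBinom cα cβ j (suc a) b)) (one* (signedBinom cα cβ j a (suc b)))))))
  where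
  one* : ∀ z → 𝟙 (does (suc (a ℕ.+ b ℕ.+ j) ℕ.≟ (cα ℕ.+ cβ))) * z ≡ z
  one* z = trans (cong (_* z) i≡1) (QP.*-identityˡ z)

coeffShift-pow-monoDiff : ∀ (k : ℕ) (u u' : List ℕ) (e : ℕ → ℕ → List ℕ) (c : List ℕ) (cα cβ : ℕ) (K : ℚ) →
  (∀ a b → zipWith ℕ._+_ u (e a b) ≡ e (suc a) b) → (∀ a b → zipWith ℕ._+_ u' (e a b) ≡ e a (suc b)) →
  (∀ a b → coeffShift (one k) (e a b) c ≡ (δℕ a cα * δℕ b cβ) * K) →
  ∀ j a b → coeffShift (pow k (monoDiff u u') j) (e a b) c ≡ powDiffCoeff cα cβ j a b * K
coeffShift-pow-monoDiff k u u' e c cα cβ K shiftˡ shiftʳ base zero a b = trans (base a b) (cong (_* K) (sym (powDiffCoeff-0 cα cβ a b)))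
coeffShift-pow-monoDiff k u u' e c cα cβ K shiftˡ shiftʳ base (suc j) a b = begin
  coeffShift (mul (monoDiff u u') P) (e a b) c
    ≡⟨ coeffShift-monoDiff u u' P (e a b) c ⟩
  coeffShift P (zipWith ℕ._+_ u (e a b)) c + neg1 * coeffShift P (zipWith ℕ._+_ u' (e a b)) c
    ≡⟨ cong₂ (λ p q → coeffShift P p c + neg1 * coeffShift P q c) (shiftˡ a b) (shiftʳ a b) ⟩
  coeffShift P (e (suc a) b) c + neg1 * coeffShift P (e a (suc b)) c
    ≡⟨ cong₂ (λ p q → p + neg1 * q) (IH (suc a) b) (IH a (suc b)) ⟩
  powDiffCoeff cα cβ j (suc a) b * K + neg1 * (powDiffCoeff cα cβ j a (suc b) * K)
    ≡⟨ factor (powDiffCoeff cα cβ j (suc a) b) (powDiffCoeff cα cβ j a (suc b)) K ⟩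
  (powDiffCoeff cα cβ j (suc a) b + neg1 * powDiffCoeff cα cβ j a (suc b)) * K
    ≡⟨ cong (_* K) (sym (powDiffCoeff-suc cα cβ j a b)) ⟩
  powDiffCoeff cα cβ (suc j) a b * K ∎
  where
  open ≡-Reasoning
  P = pow k (monoDiff u u') j
  IH = coeffShift-pow-monoDiff k u u' e c cα cβ K shiftˡ shiftʳ base j
  factor : ∀ s t K → s * K + neg1 * (t * K) ≡ (s + neg1 * t) * K
  factor s t K = trans (cong (s * K +_) (sym (QP.*-assoc neg1 t K))) (sym (QP.*-distribʳ-+ K s (neg1 * t)))

coeffShift-pow-mono : ∀ (k : ℕ) (u : List ℕ) (e : ℕ → List ℕ) (c : List ℕ) (cα : ℕ) (K : ℚ) →
  (∀ a → zipWith ℕ._+_ u (e a) ≡ e (suc a)) →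
  (∀ a → coeffShift (one k) (e a) c ≡ δℕ a cα * K) →
  ∀ j a → coeffShift (pow k [ (1ℚ , u) ] j) (e a) c ≡ δℕ (a ℕ.+ j) cα * K
coeffShift-pow-mono k u e c cα K shift base zero a = trans (base a) (cong (λ z → δℕ z cα * K) (sym (ℕP.+-identityʳ a)))
coeffShift-pow-mono k u e c cα K shift base (suc j) a =
  trans (coeffShift-mono u (pow k [ (1ℚ , u) ] j) (e a) c)
    (trans (cong (λ p → coeffShift (pow k [ (1ℚ , u) ] j) p c) (shift a))
      (trans (coeffShift-pow-mono k u e c cα K shift base j (suc a)) (cong (λ z → δℕ z cα * K) (sym (ℕP.+-suc a j)))))

data IsEven : ℕ → Set where
  even-0 : IsEven 0
  even-+2 : ∀ {n} → IsEven n → IsEven (suc (suc n))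

odd⇒pred-even : ∀ x → suc x ℕ.% 2 ≡ 1 → IsEven x
odd⇒pred-even zero _ = even-0
odd⇒pred-even (suc (suc x)) odd = even-+2 (odd⇒pred-even x odd)

∸-even : ∀ {p q} → IsEven p → IsEven q → IsEven (p ∸ q)
∸-even even-0 even-0 = even-0
∸-even even-0 (even-+2 _) = even-0
∸-even (even-+2 p) even-0 = even-+2 p
∸-even (even-+2 p) (even-+2 q) = ∸-even p q

signPow-even : ∀ {n} → IsEven n → signPow n ≡ 1ℚ
signPow-even even-0 = refl
signPow-even (even-+2 {n} e) = trans (neg-neg (signPow n)) (signPow-even e)
  where
  neg-neg : ∀ x → - - x ≡ x
  neg-neg = solve-∀ ℚ-ring

𝟙-dec-* : {P Q : Set} (dP : Dec P) (dQ : Dec Q) →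
  𝟙 (does dP) * 𝟙 (does dQ) ≡ 0ℚ ⊎ ((P × Q) × 𝟙 (does dP) * 𝟙 (does dQ) ≡ 1ℚ)
𝟙-dec-* (yes p) (yes q) = inj₂ ((p , q) , refl)
𝟙-dec-* (yes _) (no _) = inj₁ refl
𝟙-dec-* (no _) dQ = inj₁ (QP.*-zeroˡ (𝟙 (does dQ)))

-- From a = 0 the signed binomial is (-1)^(cβ - b) binom j cα, and the sign is +1 because cβ and b are even.
powDiffCoeff-from-0 : ∀ {P : Set} (g : ℚ) → g ≡ 0ℚ ⊎ (P × g ≡ 1ℚ) → ∀ cα cβ j b →
  (P → b ℕ.+ j ≡ cα ℕ.+ cβ) → IsEven cβ → IsEven b → powDiffCoeff cα cβ j 0 b * g ≡ g * binom j cα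
powDiffCoeff-from-0 g (inj₁ g≡0) cα cβ j b _ _ _ =
  ≡0⇒≡ (*≡0ʳ (powDiffCoeff cα cβ j 0 b) g g≡0) (*≡0ˡ g (binom j cα) g≡0)
powDiffCoeff-from-0 g (inj₂ (p , g≡1)) cα cβ j b deg even-cβ even-b = begin
  powDiffCoeff cα cβ j 0 b * g
    ≡⟨ cong₂ _*_ (cong₂ _*_ (δℕ-≡ (b ℕ.+ j) (cα ℕ.+ cβ) (deg p)) (cong (_* binom j cα) (signPow-even (∸-even even-cβ even-b)))) g≡1 ⟩
  (1ℚ * (1ℚ * binom j cα)) * 1ℚ
    ≡⟨ trans (QP.*-identityʳ (1ℚ * (1ℚ * binom j cα))) (QP.*-identityˡ (1ℚ * binom j cα)) ⟩
  1ℚ * binom j cα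
    ≡⟨ cong (_* binom j cα) (sym g≡1) ⟩
  g * binom j cα ∎
  where open ≡-Reasoning

zipWith-replicate-0 : ∀ xs → zipWith ℕ._+_ (L.replicate (length xs) 0) xs ≡ xs
zipWith-replicate-0 [] = refl
zipWith-replicate-0 (x ∷ xs) = cong (x ∷_) (zipWith-replicate-0 xs)

coeffShift-one≡δ : ∀ xs ys → coeffShift (one (length xs)) xs ys ≡ δ xs ys
coeffShift-one≡δ xs ys = trans (cong (λ zs → (if does (zs ≟T ys) then 1ℚ else 0ℚ) + 0ℚ) (zipWith-replicate-0 xs))
  (QP.+-identityʳ (δ xs ys))

δ-∷₁ : ∀ x y → δ (x ∷ []) (y ∷ []) ≡ δℕ x y * 1ℚ
δ-∷₁ x y = δ-∷ x y [] []

δ-∷₁′ : ∀ x y → δ (x ∷ []) (y ∷ []) ≡ δℕ y x * 1ℚ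
δ-∷₁′ x y = trans (δ-∷₁ x y) (cong (_* 1ℚ) (δℕ-sym x y))

δ-∷₂ : ∀ x1 x2 y1 y2 → δ (x1 ∷ x2 ∷ []) (y1 ∷ y2 ∷ []) ≡ δℕ x1 y1 * (δℕ x2 y2 * 1ℚ)
δ-∷₂ x1 x2 y1 y2 = trans (δ-∷ x1 y1 (x2 ∷ []) (y2 ∷ [])) (cong (δℕ x1 y1 *_) (δ-∷₁ x2 y2))

δ-∷₃ : ∀ x1 x2 x3 y1 y2 y3 → δ (x1 ∷ x2 ∷ x3 ∷ []) (y1 ∷ y2 ∷ y3 ∷ []) ≡ δℕ x1 y1 * (δℕ x2 y2 * (δℕ x3 y3 * 1ℚ))
δ-∷₃ x1 x2 x3 y1 y2 y3 = trans (δ-∷ x1 y1 (x2 ∷ x3 ∷ []) (y2 ∷ y3 ∷ [])) (cong (δℕ x1 y1 *_) (δ-∷₂ x2 x3 y2 y3))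

δ-∷₄ : ∀ x1 x2 x3 x4 y1 y2 y3 y4 →
  δ (x1 ∷ x2 ∷ x3 ∷ x4 ∷ []) (y1 ∷ y2 ∷ y3 ∷ y4 ∷ []) ≡ δℕ x1 y1 * (δℕ x2 y2 * (δℕ x3 y3 * (δℕ x4 y4 * 1ℚ)))
δ-∷₄ x1 x2 x3 x4 y1 y2 y3 y4 = trans (δ-∷ x1 y1 (x2 ∷ x3 ∷ x4 ∷ []) (y2 ∷ y3 ∷ y4 ∷ [])) (cong (δℕ x1 y1 *_) (δ-∷₃ x2 x3 x4 y2 y3 y4))

-- ClosedFormᵣ computes e(1+a₁,…,1+aᵣ ; 1+c₁,…,1+cᵣ) for even aᵢ, cᵢ of equal sum: besides δ(a,c), the i-th
-- summand of x₁^a₁ ∘ g (i ≥ 2) contributes binom a₁ cᵢ and the i-th summand of the reflected sum -binom a₁ cᵢ₋₁,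
-- both only when a₂,…,aᵢ₋₁ match c₁,…,cᵢ₋₂ and aᵢ₊₁,…,aᵣ match cᵢ₊₁,…,cᵣ (the factor Kᵢ₋₁).
module ClosedForm₄ (a1 a2 a3 a4 c1 c2 c3 c4 : ℕ) where
  c' : List ℕ
  c' = c1 ∷ c2 ∷ c3 ∷ c4 ∷ []

  e₁ e₂ e₃ e₄ : List ℕ
  e₁ = 1 ∷ 0 ∷ 0 ∷ 0 ∷ []
  e₂ = 0 ∷ 1 ∷ 0 ∷ 0 ∷ []
  e₃ = 0 ∷ 0 ∷ 1 ∷ 0 ∷ []
  e₄ = 0 ∷ 0 ∷ 0 ∷ 1 ∷ []

  K0 K1 K2 K3 : ℚ
  K0 = δℕ a2 c2 * (δℕ a3 c3 * δℕ a4 c4)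
  K1 = δℕ a3 c3 * δℕ a4 c4
  K2 = δℕ a2 c1 * δℕ a4 c4
  K3 = δℕ a2 c1 * δℕ a3 c2

  B : ℕ → ℚ
  B = binom a1

  closedForm : ℚ
  closedForm = δℕ a1 c1 * K0 + (K1 * B c2 + (K2 * B c3 + K3 * B c4)) + - (K1 * B c1 + (K2 * B c2 + K3 * B c3))

  A0 A1 A2 A3 B1 B2 B3 : Poly
  A0 = mul (pow 4 [ (1ℚ , e₁) ] a1) (monomial (0 ∷ a2 ∷ a3 ∷ a4 ∷ []))
  A1 = mul (pow 4 (monoDiff e₂ e₁) a1) (monomial (a2 ∷ 0 ∷ a3 ∷ a4 ∷ []))
  A2 = mul (pow 4 (monoDiff e₃ e₂) a1) (monomial (a2 ∷ a3 ∷ 0 ∷ a4 ∷ []))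
  A3 = mul (pow 4 (monoDiff e₄ e₃) a1) (monomial (a2 ∷ a3 ∷ a4 ∷ 0 ∷ []))
  B1 = mul (pow 4 (monoDiff e₁ e₂) a1) (monomial (0 ∷ a2 ∷ a3 ∷ a4 ∷ []))
  B2 = mul (pow 4 (monoDiff e₂ e₃) a1) (monomial (a2 ∷ 0 ∷ a3 ∷ a4 ∷ []))
  B3 = mul (pow 4 (monoDiff e₃ e₄) a1) (monomial (a2 ∷ a3 ∷ 0 ∷ a4 ∷ []))

  base : ∀ x1 x2 x3 x4 → coeffShift (one 4) (x1 ∷ x2 ∷ x3 ∷ x4 ∷ []) c' ≡ δℕ x1 c1 * (δℕ x2 c2 * (δℕ x3 c3 * (δℕ x4 c4 * 1ℚ)))
  base x1 x2 x3 x4 = trans (coeffShift-one≡δ (x1 ∷ x2 ∷ x3 ∷ x4 ∷ []) c') (δ-∷₄ x1 x2 x3 x4 c1 c2 c3 c4)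

  coeff-A0 : coeff A0 c' ≡ δℕ a1 c1 * K0
  coeff-A0 = coeffShift-pow-mono 4 e₁ (λ x → x ∷ a2 ∷ a3 ∷ a4 ∷ []) c' c1 K0 (λ _ → refl)
    (λ x → trans (base x a2 a3 a4) (reorder (δℕ x c1) (δℕ a2 c2) (δℕ a3 c3) (δℕ a4 c4))) a1 0
    where
    reorder : ∀ p q r s → p * (q * (r * (s * 1ℚ))) ≡ p * (q * (r * s))
    reorder = solve-∀ ℚ-ring

  coeff-A1 : coeff A1 c' ≡ powDiffCoeff c2 c1 a1 0 a2 * K1
  coeff-A1 = coeffShift-pow-monoDiff 4 e₂ e₁ (λ x y → y ∷ x ∷ a3 ∷ a4 ∷ []) c' c2 c1 K1 (λ _ _ → refl) (λ _ _ → refl)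
    (λ x y → trans (base y x a3 a4) (reorder (δℕ y c1) (δℕ x c2) (δℕ a3 c3) (δℕ a4 c4))) a1 0 a2
    where
    reorder : ∀ p q r s → p * (q * (r * (s * 1ℚ))) ≡ (q * p) * (r * s)
    reorder = solve-∀ ℚ-ring

  coeff-A2 : coeff A2 c' ≡ powDiffCoeff c3 c2 a1 0 a3 * K2
  coeff-A2 = coeffShift-pow-monoDiff 4 e₃ e₂ (λ x y → a2 ∷ y ∷ x ∷ a4 ∷ []) c' c3 c2 K2 (λ _ _ → refl) (λ _ _ → refl)
    (λ x y → trans (base a2 y x a4) (reorder (δℕ a2 c1) (δℕ y c2) (δℕ x c3) (δℕ a4 c4))) a1 0 a3
    where
    reorder : ∀ p q r s → p * (q * (r * (s * 1ℚ))) ≡ (r * q) * (p * s)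
    reorder = solve-∀ ℚ-ring

  coeff-A3 : coeff A3 c' ≡ powDiffCoeff c4 c3 a1 0 a4 * K3
  coeff-A3 = coeffShift-pow-monoDiff 4 e₄ e₃ (λ x y → a2 ∷ a3 ∷ y ∷ x ∷ []) c' c4 c3 K3 (λ _ _ → refl) (λ _ _ → refl)
    (λ x y → trans (base a2 a3 y x) (reorder (δℕ a2 c1) (δℕ a3 c2) (δℕ y c3) (δℕ x c4))) a1 0 a4
    where
    reorder : ∀ p q r s → p * (q * (r * (s * 1ℚ))) ≡ (s * r) * (p * q)
    reorder = solve-∀ ℚ-ring

  coeff-B1 : coeff B1 c' ≡ powDiffCoeff c1 c2 a1 0 a2 * K1
  coeff-B1 = coeffShift-pow-monoDiff 4 e₁ e₂ (λ x y → x ∷ y ∷ a3 ∷ a4 ∷ []) c' c1 c2 K1 (λ _ _ → refl) (λ _ _ → refl)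
    (λ x y → trans (base x y a3 a4) (reorder (δℕ x c1) (δℕ y c2) (δℕ a3 c3) (δℕ a4 c4))) a1 0 a2
    where
    reorder : ∀ p q r s → p * (q * (r * (s * 1ℚ))) ≡ (p * q) * (r * s)
    reorder = solve-∀ ℚ-ring

  coeff-B2 : coeff B2 c' ≡ powDiffCoeff c2 c3 a1 0 a3 * K2
  coeff-B2 = coeffShift-pow-monoDiff 4 e₂ e₃ (λ x y → a2 ∷ x ∷ y ∷ a4 ∷ []) c' c2 c3 K2 (λ _ _ → refl) (λ _ _ → refl)
    (λ x y → trans (base a2 x y a4) (reorder (δℕ a2 c1) (δℕ x c2) (δℕ y c3) (δℕ a4 c4))) a1 0 a3
    where
    reorder : ∀ p q r s → p * (q * (r * (s * 1ℚ))) ≡ (q * r) * (p * s)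
    reorder = solve-∀ ℚ-ring

  coeff-B3 : coeff B3 c' ≡ powDiffCoeff c3 c4 a1 0 a4 * K3
  coeff-B3 = coeffShift-pow-monoDiff 4 e₃ e₄ (λ x y → a2 ∷ a3 ∷ x ∷ y ∷ []) c' c3 c4 K3 (λ _ _ → refl) (λ _ _ → refl)
    (λ x y → trans (base a2 a3 x y) (reorder (δℕ a2 c1) (δℕ a3 c2) (δℕ x c3) (δℕ y c4))) a1 0 a4
    where
    reorder : ∀ p q r s → p * (q * (r * (s * 1ℚ))) ≡ (r * s) * (p * q)
    reorder = solve-∀ ℚ-ring

  ecoef-expand : ecoef (suc a1 ∷ suc a2 ∷ suc a3 ∷ suc a4 ∷ []) (suc c1 ∷ suc c2 ∷ suc c3 ∷ suc c4 ∷ []) ≡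
    (coeff A0 c' + (coeff A1 c' + (coeff A2 c' + (coeff A3 c' + 0ℚ)))) +
    signPow (suc a1) * (coeff B1 c' + (coeff B2 c' + (coeff B3 c' + 0ℚ)))
  ecoef-expand = trans (coeff-++ (A0 ++ (A1 ++ (A2 ++ (A3 ++ [])))) (scale (signPow (suc a1)) (B1 ++ (B2 ++ (B3 ++ [])))) c')
    (cong₂ _+_ (trans (coeff-++ A0 _ c') (cong (coeff A0 c' +_) (trans (coeff-++ A1 _ c') (cong (coeff A1 c' +_) (trans (coeff-++ A2 _ c') (cong (coeff A2 c' +_) (coeff-++ A3 [] c')))))))
      (trans (coeff-scale (signPow (suc a1)) (B1 ++ (B2 ++ (B3 ++ []))) c')
        (cong (signPow (suc a1) *_) (trans (coeff-++ B1 _ c') (cong (coeff B1 c' +_) (trans (coeff-++ B2 _ c') (cong (coeff B2 c' +_) (coeff-++ B3 [] c'))))))))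

  regroup : ∀ D x1 x2 x3 y1 y2 y3 → (D + (x1 + (x2 + (x3 + 0ℚ)))) + (- 1ℚ) * (y1 + (y2 + (y3 + 0ℚ))) ≡ D + (x1 + (x2 + x3)) + - (y1 + (y2 + y3))
  regroup = solve-∀ ℚ-ring

  module _ (ea1 : IsEven a1) (ea2 : IsEven a2) (ea3 : IsEven a3) (ea4 : IsEven a4)
           (ec1 : IsEven c1) (ec2 : IsEven c2) (ec3 : IsEven c3) (ec4 : IsEven c4)
           (total : a1 ℕ.+ (a2 ℕ.+ (a3 ℕ.+ a4)) ≡ c1 ℕ.+ (c2 ℕ.+ (c3 ℕ.+ c4))) where

    degree₁ : a3 ≡ c3 × a4 ≡ c4 → a2 ℕ.+ a1 ≡ c2 ℕ.+ c1
    degree₁ (refl , refl) = ℕP.+-cancelʳ-≡ (a3 ℕ.+ a4) (a2 ℕ.+ a1) (c2 ℕ.+ c1)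
      (trans (sym (rearrange a1 a2 (a3 ℕ.+ a4))) (trans total (rearrange c1 c2 (a3 ℕ.+ a4))))
      where
      rearrange : ∀ x y t → x ℕ.+ (y ℕ.+ t) ≡ (y ℕ.+ x) ℕ.+ t
      rearrange = NS.solve-∀

    degree₂ : a2 ≡ c1 × a4 ≡ c4 → a3 ℕ.+ a1 ≡ c3 ℕ.+ c2
    degree₂ (refl , refl) = ℕP.+-cancelʳ-≡ (a2 ℕ.+ a4) (a3 ℕ.+ a1) (c3 ℕ.+ c2)
      (trans (sym (rearrangeˡ a1 a2 a3 a4)) (trans total (rearrangeʳ a2 c2 c3 a4)))
      where
      rearrangeˡ : ∀ a1 c1 a3 c4 → a1 ℕ.+ (c1 ℕ.+ (a3 ℕ.+ c4)) ≡ (a3 ℕ.+ a1) ℕ.+ (c1 ℕ.+ c4)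
      rearrangeˡ = NS.solve-∀
      rearrangeʳ : ∀ c1 c2 c3 c4 → c1 ℕ.+ (c2 ℕ.+ (c3 ℕ.+ c4)) ≡ (c3 ℕ.+ c2) ℕ.+ (c1 ℕ.+ c4)
      rearrangeʳ = NS.solve-∀

    degree₃ : a2 ≡ c1 × a3 ≡ c2 → a4 ℕ.+ a1 ≡ c4 ℕ.+ c3
    degree₃ (refl , refl) = ℕP.+-cancelʳ-≡ (a2 ℕ.+ a3) (a4 ℕ.+ a1) (c4 ℕ.+ c3)
      (trans (sym (rearrangeˡ a1 a2 a3 a4)) (trans total (rearrangeʳ a2 a3 c3 c4)))
      where
      rearrangeˡ : ∀ a1 c1 c2 a4 → a1 ℕ.+ (c1 ℕ.+ (c2 ℕ.+ a4)) ≡ (a4 ℕ.+ a1) ℕ.+ (c1 ℕ.+ c2)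
      rearrangeˡ = NS.solve-∀
      rearrangeʳ : ∀ c1 c2 c3 c4 → c1 ℕ.+ (c2 ℕ.+ (c3 ℕ.+ c4)) ≡ (c4 ℕ.+ c3) ℕ.+ (c1 ℕ.+ c2)
      rearrangeʳ = NS.solve-∀

    ecoef≡closedForm : ecoef (suc a1 ∷ suc a2 ∷ suc a3 ∷ suc a4 ∷ []) (suc c1 ∷ suc c2 ∷ suc c3 ∷ suc c4 ∷ []) ≡ closedForm
    ecoef≡closedForm = trans ecoef-expand (trans (cong₂ _+_
        (cong₂ _+_ coeff-A0 (cong₂ _+_ (trans coeff-A1 A1≡) (cong₂ _+_ (trans coeff-A2 A2≡) (cong (_+ 0ℚ) (trans coeff-A3 A3≡)))))
        (cong₂ _*_ (cong -_ (signPow-even ea1)) (cong₂ _+_ (trans coeff-B1 B1≡) (cong₂ _+_ (trans coeff-B2 B2≡) (cong (_+ 0ℚ) (trans coeff-B3 B3≡))))))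
      (regroup (δℕ a1 c1 * K0) (K1 * B c2) (K2 * B c3) (K3 * B c4) (K1 * B c1) (K2 * B c2) (K3 * B c3)))
      where
      A1≡ = powDiffCoeff-from-0 K1 (𝟙-dec-* (a3 ℕ.≟ c3) (a4 ℕ.≟ c4)) c2 c1 a1 a2 degree₁ ec1 ea2
      A2≡ = powDiffCoeff-from-0 K2 (𝟙-dec-* (a2 ℕ.≟ c1) (a4 ℕ.≟ c4)) c3 c2 a1 a3 degree₂ ec2 ea3
      A3≡ = powDiffCoeff-from-0 K3 (𝟙-dec-* (a2 ℕ.≟ c1) (a3 ℕ.≟ c2)) c4 c3 a1 a4 degree₃ ec3 ea4
      B1≡ = powDiffCoeff-from-0 K1 (𝟙-dec-* (a3 ℕ.≟ c3) (a4 ℕ.≟ c4)) c1 c2 a1 a2 (λ p → trans (degree₁ p) (ℕP.+-comm c2 c1)) ec2 ea2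
      B2≡ = powDiffCoeff-from-0 K2 (𝟙-dec-* (a2 ℕ.≟ c1) (a4 ℕ.≟ c4)) c2 c3 a1 a3 (λ p → trans (degree₂ p) (ℕP.+-comm c3 c2)) ec3 ea3
      B3≡ = powDiffCoeff-from-0 K3 (𝟙-dec-* (a2 ℕ.≟ c1) (a3 ℕ.≟ c2)) c3 c4 a1 a4 (λ p → trans (degree₃ p) (ℕP.+-comm c4 c3)) ec4 ea4

module ClosedForm₃ (a1 a2 a3 c1 c2 c3 : ℕ) where
  c' : List ℕ
  c' = c1 ∷ c2 ∷ c3 ∷ []

  e₁ e₂ e₃ : List ℕ
  e₁ = 1 ∷ 0 ∷ 0 ∷ []
  e₂ = 0 ∷ 1 ∷ 0 ∷ []
  e₃ = 0 ∷ 0 ∷ 1 ∷ []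

  K0 K1 K2 : ℚ
  K0 = δℕ a2 c2 * δℕ a3 c3
  K1 = δℕ a3 c3
  K2 = δℕ a2 c1

  B : ℕ → ℚ
  B = binom a1

  closedForm : ℚ
  closedForm = δℕ a1 c1 * K0 + (K1 * B c2 + K2 * B c3) + - (K1 * B c1 + K2 * B c2)

  A0 A1 A2 B1 B2 : Poly
  A0 = mul (pow 3 [ (1ℚ , e₁) ] a1) (monomial (0 ∷ a2 ∷ a3 ∷ []))
  A1 = mul (pow 3 (monoDiff e₂ e₁) a1) (monomial (a2 ∷ 0 ∷ a3 ∷ []))
  A2 = mul (pow 3 (monoDiff e₃ e₂) a1) (monomial (a2 ∷ a3 ∷ 0 ∷ []))
  B1 = mul (pow 3 (monoDiff e₁ e₂) a1) (monomial (0 ∷ a2 ∷ a3 ∷ []))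
  B2 = mul (pow 3 (monoDiff e₂ e₃) a1) (monomial (a2 ∷ 0 ∷ a3 ∷ []))

  base : ∀ x1 x2 x3 → coeffShift (one 3) (x1 ∷ x2 ∷ x3 ∷ []) c' ≡ δℕ x1 c1 * (δℕ x2 c2 * (δℕ x3 c3 * 1ℚ))
  base x1 x2 x3 = trans (coeffShift-one≡δ (x1 ∷ x2 ∷ x3 ∷ []) c') (δ-∷₃ x1 x2 x3 c1 c2 c3)

  coeff-A0 : coeff A0 c' ≡ δℕ a1 c1 * K0
  coeff-A0 = coeffShift-pow-mono 3 e₁ (λ x → x ∷ a2 ∷ a3 ∷ []) c' c1 K0 (λ _ → refl)
    (λ x → trans (base x a2 a3) (reorder (δℕ x c1) (δℕ a2 c2) (δℕ a3 c3))) a1 0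
    where
    reorder : ∀ p q r → p * (q * (r * 1ℚ)) ≡ p * (q * r)
    reorder = solve-∀ ℚ-ring

  coeff-A1 : coeff A1 c' ≡ powDiffCoeff c2 c1 a1 0 a2 * K1
  coeff-A1 = coeffShift-pow-monoDiff 3 e₂ e₁ (λ x y → y ∷ x ∷ a3 ∷ []) c' c2 c1 K1 (λ _ _ → refl) (λ _ _ → refl)
    (λ x y → trans (base y x a3) (reorder (δℕ y c1) (δℕ x c2) (δℕ a3 c3))) a1 0 a2
    where
    reorder : ∀ p q r → p * (q * (r * 1ℚ)) ≡ (q * p) * r
    reorder = solve-∀ ℚ-ring

  coeff-A2 : coeff A2 c' ≡ powDiffCoeff c3 c2 a1 0 a3 * K2
  coeff-A2 = coeffShift-pow-monoDiff 3 e₃ e₂ (λ x y → a2 ∷ y ∷ x ∷ []) c' c3 c2 K2 (λ _ _ → refl) (λ _ _ → refl)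
    (λ x y → trans (base a2 y x) (reorder (δℕ a2 c1) (δℕ y c2) (δℕ x c3))) a1 0 a3
    where
    reorder : ∀ p q r → p * (q * (r * 1ℚ)) ≡ (r * q) * p
    reorder = solve-∀ ℚ-ring

  coeff-B1 : coeff B1 c' ≡ powDiffCoeff c1 c2 a1 0 a2 * K1
  coeff-B1 = coeffShift-pow-monoDiff 3 e₁ e₂ (λ x y → x ∷ y ∷ a3 ∷ []) c' c1 c2 K1 (λ _ _ → refl) (λ _ _ → refl)
    (λ x y → trans (base x y a3) (reorder (δℕ x c1) (δℕ y c2) (δℕ a3 c3))) a1 0 a2
    where
    reorder : ∀ p q r → p * (q * (r * 1ℚ)) ≡ (p * q) * r
    reorder = solve-∀ ℚ-ring

  coeff-B2 : coeff B2 c' ≡ powDiffCoeff c2 c3 a1 0 a3 * K2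
  coeff-B2 = coeffShift-pow-monoDiff 3 e₂ e₃ (λ x y → a2 ∷ x ∷ y ∷ []) c' c2 c3 K2 (λ _ _ → refl) (λ _ _ → refl)
    (λ x y → trans (base a2 x y) (reorder (δℕ a2 c1) (δℕ x c2) (δℕ y c3))) a1 0 a3
    where
    reorder : ∀ p q r → p * (q * (r * 1ℚ)) ≡ (q * r) * p
    reorder = solve-∀ ℚ-ring

  ecoef-expand : ecoef (suc a1 ∷ suc a2 ∷ suc a3 ∷ []) (suc c1 ∷ suc c2 ∷ suc c3 ∷ []) ≡
    (coeff A0 c' + (coeff A1 c' + (coeff A2 c' + 0ℚ))) + signPow (suc a1) * (coeff B1 c' + (coeff B2 c' + 0ℚ))
  ecoef-expand = trans (coeff-++ (A0 ++ (A1 ++ (A2 ++ []))) (scale (signPow (suc a1)) (B1 ++ (B2 ++ []))) c')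
    (cong₂ _+_ (trans (coeff-++ A0 _ c') (cong (coeff A0 c' +_) (trans (coeff-++ A1 _ c') (cong (coeff A1 c' +_) (coeff-++ A2 [] c')))))
      (trans (coeff-scale (signPow (suc a1)) (B1 ++ (B2 ++ [])) c')
        (cong (signPow (suc a1) *_) (trans (coeff-++ B1 _ c') (cong (coeff B1 c' +_) (coeff-++ B2 [] c'))))))

  regroup : ∀ D x1 x2 y1 y2 → (D + (x1 + (x2 + 0ℚ))) + (- 1ℚ) * (y1 + (y2 + 0ℚ)) ≡ D + (x1 + x2) + - (y1 + y2)
  regroup = solve-∀ ℚ-ring

  module _ (ea1 : IsEven a1) (ea2 : IsEven a2) (ea3 : IsEven a3) (ec1 : IsEven c1) (ec2 : IsEven c2) (ec3 : IsEven c3)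
           (total : a1 ℕ.+ (a2 ℕ.+ a3) ≡ c1 ℕ.+ (c2 ℕ.+ c3)) where

    degree₁ : a3 ≡ c3 → a2 ℕ.+ a1 ≡ c2 ℕ.+ c1
    degree₁ refl = ℕP.+-cancelʳ-≡ a3 (a2 ℕ.+ a1) (c2 ℕ.+ c1) (trans (sym (rearrange a1 a2 a3)) (trans total (rearrange c1 c2 a3)))
      where
      rearrange : ∀ x y t → x ℕ.+ (y ℕ.+ t) ≡ (y ℕ.+ x) ℕ.+ t
      rearrange = NS.solve-∀

    degree₂ : a2 ≡ c1 → a3 ℕ.+ a1 ≡ c3 ℕ.+ c2
    degree₂ refl = ℕP.+-cancelʳ-≡ a2 (a3 ℕ.+ a1) (c3 ℕ.+ c2) (trans (sym (rearrangeˡ a1 a2 a3)) (trans total (rearrangeʳ a2 c2 c3)))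
      where
      rearrangeˡ : ∀ a1 c1 a3 → a1 ℕ.+ (c1 ℕ.+ a3) ≡ (a3 ℕ.+ a1) ℕ.+ c1
      rearrangeˡ = NS.solve-∀
      rearrangeʳ : ∀ c1 c2 c3 → c1 ℕ.+ (c2 ℕ.+ c3) ≡ (c3 ℕ.+ c2) ℕ.+ c1
      rearrangeʳ = NS.solve-∀

    ecoef≡closedForm : ecoef (suc a1 ∷ suc a2 ∷ suc a3 ∷ []) (suc c1 ∷ suc c2 ∷ suc c3 ∷ []) ≡ closedForm
    ecoef≡closedForm = trans ecoef-expand (trans (cong₂ _+_
        (cong₂ _+_ coeff-A0 (cong₂ _+_ (trans coeff-A1 A1≡) (cong (_+ 0ℚ) (trans coeff-A2 A2≡))))
        (cong₂ _*_ (cong -_ (signPow-even ea1)) (cong₂ _+_ (trans coeff-B1 B1≡) (cong (_+ 0ℚ) (trans coeff-B2 B2≡)))))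
      (regroup (δℕ a1 c1 * K0) (K1 * B c2) (K2 * B c3) (K1 * B c1) (K2 * B c2)))
      where
      A1≡ = powDiffCoeff-from-0 K1 (𝟙-dec (a3 ℕ.≟ c3)) c2 c1 a1 a2 degree₁ ec1 ea2
      A2≡ = powDiffCoeff-from-0 K2 (𝟙-dec (a2 ℕ.≟ c1)) c3 c2 a1 a3 degree₂ ec2 ea3
      B1≡ = powDiffCoeff-from-0 K1 (𝟙-dec (a3 ℕ.≟ c3)) c1 c2 a1 a2 (λ p → trans (degree₁ p) (ℕP.+-comm c2 c1)) ec2 ea2
      B2≡ = powDiffCoeff-from-0 K2 (𝟙-dec (a2 ℕ.≟ c1)) c2 c3 a1 a3 (λ p → trans (degree₂ p) (ℕP.+-comm c3 c2)) ec3 ea3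

module ClosedForm₂ (a1 a2 c1 c2 : ℕ) where
  c' : List ℕ
  c' = c1 ∷ c2 ∷ []

  e₁ e₂ : List ℕ
  e₁ = 1 ∷ 0 ∷ []
  e₂ = 0 ∷ 1 ∷ []

  B : ℕ → ℚ
  B = binom a1

  closedForm : ℚ
  closedForm = δℕ a1 c1 * δℕ a2 c2 + B c2 + - B c1

  A0 A1 B1 : Poly
  A0 = mul (pow 2 [ (1ℚ , e₁) ] a1) (monomial (0 ∷ a2 ∷ []))
  A1 = mul (pow 2 (monoDiff e₂ e₁) a1) (monomial (a2 ∷ 0 ∷ []))
  B1 = mul (pow 2 (monoDiff e₁ e₂) a1) (monomial (0 ∷ a2 ∷ []))

  base : ∀ x1 x2 → coeffShift (one 2) (x1 ∷ x2 ∷ []) c' ≡ δℕ x1 c1 * (δℕ x2 c2 * 1ℚ)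
  base x1 x2 = trans (coeffShift-one≡δ (x1 ∷ x2 ∷ []) c') (δ-∷₂ x1 x2 c1 c2)

  coeff-A0 : coeff A0 c' ≡ δℕ a1 c1 * δℕ a2 c2
  coeff-A0 = coeffShift-pow-mono 2 e₁ (λ x → x ∷ a2 ∷ []) c' c1 (δℕ a2 c2) (λ _ → refl)
    (λ x → trans (base x a2) (cong (δℕ x c1 *_) (QP.*-identityʳ (δℕ a2 c2)))) a1 0

  coeff-A1 : coeff A1 c' ≡ powDiffCoeff c2 c1 a1 0 a2 * 1ℚ
  coeff-A1 = coeffShift-pow-monoDiff 2 e₂ e₁ (λ x y → y ∷ x ∷ []) c' c2 c1 1ℚ (λ _ _ → refl) (λ _ _ → refl)
    (λ x y → trans (base y x) (reorder (δℕ y c1) (δℕ x c2))) a1 0 a2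
    where
    reorder : ∀ p q → p * (q * 1ℚ) ≡ (q * p) * 1ℚ
    reorder = solve-∀ ℚ-ring

  coeff-B1 : coeff B1 c' ≡ powDiffCoeff c1 c2 a1 0 a2 * 1ℚ
  coeff-B1 = coeffShift-pow-monoDiff 2 e₁ e₂ (λ x y → x ∷ y ∷ []) c' c1 c2 1ℚ (λ _ _ → refl) (λ _ _ → refl)
    (λ x y → trans (base x y) (sym (QP.*-assoc (δℕ x c1) (δℕ y c2) 1ℚ))) a1 0 a2

  ecoef-expand : ecoef (suc a1 ∷ suc a2 ∷ []) (suc c1 ∷ suc c2 ∷ []) ≡
    (coeff A0 c' + (coeff A1 c' + 0ℚ)) + signPow (suc a1) * (coeff B1 c' + 0ℚ)
  ecoef-expand = trans (coeff-++ (A0 ++ (A1 ++ [])) (scale (signPow (suc a1)) (B1 ++ [])) c')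
    (cong₂ _+_ (trans (coeff-++ A0 _ c') (cong (coeff A0 c' +_) (coeff-++ A1 [] c')))
      (trans (coeff-scale (signPow (suc a1)) (B1 ++ []) c') (cong (signPow (suc a1) *_) (coeff-++ B1 [] c'))))

  regroup : ∀ D x1 y1 → (D + (1ℚ * x1 + 0ℚ)) + (- 1ℚ) * (1ℚ * y1 + 0ℚ) ≡ D + x1 + - y1
  regroup = solve-∀ ℚ-ring

  module _ (ea1 : IsEven a1) (ea2 : IsEven a2) (ec1 : IsEven c1) (ec2 : IsEven c2)
           (total : a1 ℕ.+ a2 ≡ c1 ℕ.+ c2) where

    degree : a2 ℕ.+ a1 ≡ c2 ℕ.+ c1
    degree = trans (ℕP.+-comm a2 a1) (trans total (ℕP.+-comm c1 c2))

    ecoef≡closedForm : ecoef (suc a1 ∷ suc a2 ∷ []) (suc c1 ∷ suc c2 ∷ []) ≡ closedForm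
    ecoef≡closedForm = trans ecoef-expand (trans (cong₂ _+_
        (cong₂ _+_ coeff-A0 (cong (_+ 0ℚ) (trans coeff-A1 A1≡)))
        (cong₂ _*_ (cong -_ (signPow-even ea1)) (cong (_+ 0ℚ) (trans coeff-B1 B1≡))))
      (regroup (δℕ a1 c1 * δℕ a2 c2) (B c2) (B c1)))
      where
      always : 1ℚ ≡ 0ℚ ⊎ (⊤ × 1ℚ ≡ 1ℚ)
      always = inj₂ (tt , refl)
      A1≡ = powDiffCoeff-from-0 1ℚ always c2 c1 a1 a2 (λ _ → degree) ec1 ea2
      B1≡ = powDiffCoeff-from-0 1ℚ always c1 c2 a1 a2 (λ _ → trans degree (ℕP.+-comm c2 c1)) ec2 ea2

𝟙-*-cong : {P : Set} (d : Dec P) {A B : ℚ} → (P → A ≡ B) → 𝟙 (does d) * A ≡ 𝟙 (does d) * B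
𝟙-*-cong (yes p) A≡B = cong (1ℚ *_) (A≡B p)
𝟙-*-cong (no _) {A} {B} _ = trans (QP.*-zeroˡ A) (sym (QP.*-zeroˡ B))

-- Summing e(n ; ·) over the shuffles of m′ with one letter q: inserting the closed forms of ClosedForm₄ term by term,
-- everything cancels except δ(q, n₁) δ(n₂n₃n₄, m′) and, for each nᵢ = q (i ≥ 2), the closed form of
-- e(n with nᵢ deleted ; m′) from ClosedForm₃.
module ShuffleSingle₄ (x1 x2 x3 x4 y1 y2 y3 q : ℕ)
  (e1 : IsEven x1) (e2 : IsEven x2) (e3 : IsEven x3) (e4 : IsEven x4)
  (f1 : IsEven y1) (f2 : IsEven y2) (f3 : IsEven y3) (fq : IsEven q)
  (total : x1 ℕ.+ (x2 ℕ.+ (x3 ℕ.+ x4)) ≡ q ℕ.+ (y1 ℕ.+ (y2 ℕ.+ y3))) where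

  n m' : List ℕ
  n = suc x1 ∷ suc x2 ∷ suc x3 ∷ suc x4 ∷ []
  m' = suc y1 ∷ suc y2 ∷ suc y3 ∷ []

  degree-without₂ : x2 ≡ q → x1 ℕ.+ (x3 ℕ.+ x4) ≡ y1 ℕ.+ (y2 ℕ.+ y3)
  degree-without₂ refl = ℕP.+-cancelˡ-≡ x2 _ _ (trans (rearrange x1 x2 x3 x4) total)
    where
    rearrange : ∀ a b c d → b ℕ.+ (a ℕ.+ (c ℕ.+ d)) ≡ a ℕ.+ (b ℕ.+ (c ℕ.+ d))
    rearrange = NS.solve-∀

  degree-without₃ : x3 ≡ q → x1 ℕ.+ (x2 ℕ.+ x4) ≡ y1 ℕ.+ (y2 ℕ.+ y3)
  degree-without₃ refl = ℕP.+-cancelˡ-≡ x3 _ _ (trans (rearrange x1 x2 x3 x4) total)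
    where
    rearrange : ∀ a b c d → c ℕ.+ (a ℕ.+ (b ℕ.+ d)) ≡ a ℕ.+ (b ℕ.+ (c ℕ.+ d))
    rearrange = NS.solve-∀

  degree-without₄ : x4 ≡ q → x1 ℕ.+ (x2 ℕ.+ x3) ≡ y1 ℕ.+ (y2 ℕ.+ y3)
  degree-without₄ refl = ℕP.+-cancelˡ-≡ x4 _ _ (trans (rearrange x1 x2 x3 x4) total)
    where
    rearrange : ∀ a b c d → d ℕ.+ (a ℕ.+ (b ℕ.+ c)) ≡ a ℕ.+ (b ℕ.+ (c ℕ.+ d))
    rearrange = NS.solve-∀

  regroup : ∀ (i1a i1b i1c i1q i2a i2b i2c i2q i3a i3b i3c i3q i4a i4b i4c i4q ba bb bc bq : ℚ) →
    ((i1a * (i2b * (i3c * i4q)) + ((i3c * i4q) * bb + ((i2a * i4q) * bc + (i2a * i3b) * bq)) + - ((i3c * i4q) * ba + ((i2a * i4q) * bb + (i2a * i3b) * bc))) + ((i1a * (i2b * (i3q * i4c)) + ((i3q * i4c) * bb + ((i2a * i4c) * bq + (i2a * i3b) * bc)) + - ((i3q * i4c) * ba + ((i2a * i4c) * bb + (i2a * i3b) * bq))) + ((i1a * (i2q * (i3b * i4c)) + ((i3b * i4c) * bq + ((i2a * i4c) * bb + (i2a * i3q) * bc)) + - ((i3b * i4c) * ba + ((i2a * i4c) * bq + (i2a * i3q) * bb))) + ((i1q * (i2a * (i3b * i4c)) + ((i3b * i4c) * ba + ((i2q * i4c) * bb + (i2q * i3a) * bc)) + - ((i3b * i4c) * bq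 + ((i2q * i4c) * ba + (i2q * i3a) * bb))) + 0ℚ))))
    ≡ (i1q * 1ℚ) * (i2a * (i3b * (i4c * 1ℚ))) + (i2q * (i1a * (i3b * i4c) + (i4c * bb + i3a * bc) + - (i4c * ba + i3a * bb)) + (i3q * (i1a * (i2b * i4c) + (i4c * bb + i2a * bc) + - (i4c * ba + i2a * bb)) + i4q * (i1a * (i2b * i3c) + (i3c * bb + i2a * bc) + - (i3c * ba + i2a * bb))))
  regroup = solve-∀ ℚ-ring

  Σ-shuffle : Σ[ shuffle m' (suc q ∷ []) ] (λ w → ecoef n w) ≡
      δ (suc q ∷ []) (take 1 n) * δ (drop 1 n) m' +
      (δℕ (suc x2) (suc q) * ecoef (suc x1 ∷ suc x3 ∷ suc x4 ∷ []) m' +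
      (δℕ (suc x3) (suc q) * ecoef (suc x1 ∷ suc x2 ∷ suc x4 ∷ []) m' +
       δℕ (suc x4) (suc q) * ecoef (suc x1 ∷ suc x2 ∷ suc x3 ∷ []) m'))
  Σ-shuffle = trans (cong₂ _+_ w₁ (cong₂ _+_ w₂ (cong₂ _+_ w₃ (cong (_+ 0ℚ) w₄))))
    (trans (regroup (δℕ x1 y1) (δℕ x1 y2) (δℕ x1 y3) (δℕ x1 q) (δℕ x2 y1) (δℕ x2 y2) (δℕ x2 y3) (δℕ x2 q)
                    (δℕ x3 y1) (δℕ x3 y2) (δℕ x3 y3) (δℕ x3 q) (δℕ x4 y1) (δℕ x4 y2) (δℕ x4 y3) (δℕ x4 q)
                    (binom x1 y1) (binom x1 y2) (binom x1 y3) (binom x1 q))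
      (sym (cong₂ _+_ (cong₂ _*_ (δ-∷₁′ (suc q) (suc x1)) (δ-∷₃ (suc x2) (suc x3) (suc x4) (suc y1) (suc y2) (suc y3)))
             (cong₂ _+_ (𝟙-*-cong (x2 ℕ.≟ q) (λ e → ClosedForm₃.ecoef≡closedForm x1 x3 x4 y1 y2 y3 e1 e3 e4 f1 f2 f3 (degree-without₂ e)))
               (cong₂ _+_ (𝟙-*-cong (x3 ℕ.≟ q) (λ e → ClosedForm₃.ecoef≡closedForm x1 x2 x4 y1 y2 y3 e1 e2 e4 f1 f2 f3 (degree-without₃ e)))
                          (𝟙-*-cong (x4 ℕ.≟ q) (λ e → ClosedForm₃.ecoef≡closedForm x1 x2 x3 y1 y2 y3 e1 e2 e3 f1 f2 f3 (degree-without₄ e))))))))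
    where
    rearrange₁ : ∀ q y1 y2 y3 → q ℕ.+ (y1 ℕ.+ (y2 ℕ.+ y3)) ≡ y1 ℕ.+ (y2 ℕ.+ (y3 ℕ.+ q))
    rearrange₁ = NS.solve-∀
    rearrange₂ : ∀ q y1 y2 y3 → q ℕ.+ (y1 ℕ.+ (y2 ℕ.+ y3)) ≡ y1 ℕ.+ (y2 ℕ.+ (q ℕ.+ y3))
    rearrange₂ = NS.solve-∀
    rearrange₃ : ∀ q y1 y2 y3 → q ℕ.+ (y1 ℕ.+ (y2 ℕ.+ y3)) ≡ y1 ℕ.+ (q ℕ.+ (y2 ℕ.+ y3))
    rearrange₃ = NS.solve-∀
    w₁ = ClosedForm₄.ecoef≡closedForm x1 x2 x3 x4 y1 y2 y3 q e1 e2 e3 e4 f1 f2 f3 fq (trans total (rearrange₁ q y1 y2 y3))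
    w₂ = ClosedForm₄.ecoef≡closedForm x1 x2 x3 x4 y1 y2 q y3 e1 e2 e3 e4 f1 f2 fq f3 (trans total (rearrange₂ q y1 y2 y3))
    w₃ = ClosedForm₄.ecoef≡closedForm x1 x2 x3 x4 y1 q y2 y3 e1 e2 e3 e4 f1 fq f2 f3 (trans total (rearrange₃ q y1 y2 y3))
    w₄ = ClosedForm₄.ecoef≡closedForm x1 x2 x3 x4 q y1 y2 y3 e1 e2 e3 e4 fq f1 f2 f3 total

module ShuffleSingle₃ (x1 x2 x3 y1 y2 q : ℕ)
  (e1 : IsEven x1) (e2 : IsEven x2) (e3 : IsEven x3) (f1 : IsEven y1) (f2 : IsEven y2) (fq : IsEven q)
  (total : x1 ℕ.+ (x2 ℕ.+ x3) ≡ q ℕ.+ (y1 ℕ.+ y2)) where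

  n m' : List ℕ
  n = suc x1 ∷ suc x2 ∷ suc x3 ∷ []
  m' = suc y1 ∷ suc y2 ∷ []

  degree-without₂ : x2 ≡ q → x1 ℕ.+ x3 ≡ y1 ℕ.+ y2
  degree-without₂ refl = ℕP.+-cancelˡ-≡ x2 _ _ (trans (rearrange x1 x2 x3) total)
    where
    rearrange : ∀ a b c → b ℕ.+ (a ℕ.+ c) ≡ a ℕ.+ (b ℕ.+ c)
    rearrange = NS.solve-∀

  degree-without₃ : x3 ≡ q → x1 ℕ.+ x2 ≡ y1 ℕ.+ y2
  degree-without₃ refl = ℕP.+-cancelˡ-≡ x3 _ _ (trans (rearrange x1 x2 x3) total)
    where
    rearrange : ∀ a b c → c ℕ.+ (a ℕ.+ b) ≡ a ℕ.+ (b ℕ.+ c)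
    rearrange = NS.solve-∀

  regroup : ∀ (i1a i1b i1q i2a i2b i2q i3a i3b i3q ba bb bq : ℚ) →
    ((i1a * (i2b * i3q) + (i3q * bb + i2a * bq) + - (i3q * ba + i2a * bb)) + ((i1a * (i2q * i3b) + (i3b * bq + i2a * bb) + - (i3b * ba + i2a * bq)) + ((i1q * (i2a * i3b) + (i3b * ba + i2q * bb) + - (i3b * bq + i2q * ba)) + 0ℚ)))
    ≡ (i1q * 1ℚ) * (i2a * (i3b * 1ℚ)) + (i2q * (i1a * i3b + bb + - ba) + i3q * (i1a * i2b + bb + - ba))
  regroup = solve-∀ ℚ-ring

  Σ-shuffle : Σ[ shuffle m' (suc q ∷ []) ] (λ w → ecoef n w) ≡
      δ (suc q ∷ []) (take 1 n) * δ (drop 1 n) m' +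
      (δℕ (suc x2) (suc q) * ecoef (suc x1 ∷ suc x3 ∷ []) m' +
       δℕ (suc x3) (suc q) * ecoef (suc x1 ∷ suc x2 ∷ []) m')
  Σ-shuffle = trans (cong₂ _+_ w₁ (cong₂ _+_ w₂ (cong (_+ 0ℚ) w₃)))
    (trans (regroup (δℕ x1 y1) (δℕ x1 y2) (δℕ x1 q) (δℕ x2 y1) (δℕ x2 y2) (δℕ x2 q)
                    (δℕ x3 y1) (δℕ x3 y2) (δℕ x3 q) (binom x1 y1) (binom x1 y2) (binom x1 q))
      (sym (cong₂ _+_ (cong₂ _*_ (δ-∷₁′ (suc q) (suc x1)) (δ-∷₂ (suc x2) (suc x3) (suc y1) (suc y2)))
             (cong₂ _+_ (𝟙-*-cong (x2 ℕ.≟ q) (λ e → ClosedForm₂.ecoef≡closedForm x1 x3 y1 y2 e1 e3 f1 f2 (degree-without₂ e)))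
                        (𝟙-*-cong (x3 ℕ.≟ q) (λ e → ClosedForm₂.ecoef≡closedForm x1 x2 y1 y2 e1 e2 f1 f2 (degree-without₃ e)))))))
    where
    rearrange₁ : ∀ q y1 y2 → q ℕ.+ (y1 ℕ.+ y2) ≡ y1 ℕ.+ (y2 ℕ.+ q)
    rearrange₁ = NS.solve-∀
    rearrange₂ : ∀ q y1 y2 → q ℕ.+ (y1 ℕ.+ y2) ≡ y1 ℕ.+ (q ℕ.+ y2)
    rearrange₂ = NS.solve-∀
    w₁ = ClosedForm₃.ecoef≡closedForm x1 x2 x3 y1 y2 q e1 e2 e3 f1 f2 fq (trans total (rearrange₁ q y1 y2))
    w₂ = ClosedForm₃.ecoef≡closedForm x1 x2 x3 y1 q y2 e1 e2 e3 f1 fq f2 (trans total (rearrange₂ q y1 y2))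
    w₃ = ClosedForm₃.ecoef≡closedForm x1 x2 x3 q y1 y2 e1 e2 e3 fq f1 f2 total

-- Shuffling m′ with a word r₁r₂ of two letters, the analogous recombination leaves, for each way of placing m′
-- in two of the last three slots of n, the two-letter closed form e(n₁nₗ ; r₁r₂) (leadingTerms), plus terms in
-- which two of n₂n₃n₄ equal r₁r₂ in order, weighted by e(n with them deleted ; m′) (pairDeleted).
module ShufflePair₄ (x1 x2 x3 x4 y1 y2 r1 r2 : ℕ)
  (e1 : IsEven x1) (e2 : IsEven x2) (e3 : IsEven x3) (e4 : IsEven x4)
  (f1 : IsEven y1) (f2 : IsEven y2) (g1 : IsEven r1) (g2 : IsEven r2)
  (total : x1 ℕ.+ (x2 ℕ.+ (x3 ℕ.+ x4)) ≡ r1 ℕ.+ (r2 ℕ.+ (y1 ℕ.+ y2))) where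

  n m' : List ℕ
  n = suc x1 ∷ suc x2 ∷ suc x3 ∷ suc x4 ∷ []
  m' = suc y1 ∷ suc y2 ∷ []

  leadingTerms : ℚ
  leadingTerms = ClosedForm₂.closedForm x1 x4 r1 r2 * (δℕ x2 y1 * δℕ x3 y2) +
    (ClosedForm₂.closedForm x1 x3 r1 r2 * (δℕ x2 y1 * δℕ x4 y2) + ClosedForm₂.closedForm x1 x2 r1 r2 * (δℕ x3 y1 * δℕ x4 y2))

  pairDeleted : ℚ
  pairDeleted = δℕ x3 r1 * (δℕ x4 r2 * ecoef (suc x1 ∷ suc x2 ∷ []) m') +
    (δℕ x2 r1 * (δℕ x4 r2 * ecoef (suc x1 ∷ suc x3 ∷ []) m') + δℕ x2 r1 * (δℕ x3 r2 * ecoef (suc x1 ∷ suc x4 ∷ []) m'))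

  degree-without₃₄ : x3 ≡ r1 → x4 ≡ r2 → x1 ℕ.+ x2 ≡ y1 ℕ.+ y2
  degree-without₃₄ refl refl = ℕP.+-cancelˡ-≡ (x3 ℕ.+ x4) _ _ (trans (rearrange x1 x2 x3 x4) (trans total (sym (ℕP.+-assoc x3 x4 _))))
    where
    rearrange : ∀ a b c d → (c ℕ.+ d) ℕ.+ (a ℕ.+ b) ≡ a ℕ.+ (b ℕ.+ (c ℕ.+ d))
    rearrange = NS.solve-∀

  degree-without₂₄ : x2 ≡ r1 → x4 ≡ r2 → x1 ℕ.+ x3 ≡ y1 ℕ.+ y2
  degree-without₂₄ refl refl = ℕP.+-cancelˡ-≡ (x2 ℕ.+ x4) _ _ (trans (rearrange x1 x2 x3 x4) (trans total (sym (ℕP.+-assoc x2 x4 _))))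
    where
    rearrange : ∀ a b c d → (b ℕ.+ d) ℕ.+ (a ℕ.+ c) ≡ a ℕ.+ (b ℕ.+ (c ℕ.+ d))
    rearrange = NS.solve-∀

  degree-without₂₃ : x2 ≡ r1 → x3 ≡ r2 → x1 ℕ.+ x4 ≡ y1 ℕ.+ y2
  degree-without₂₃ refl refl = ℕP.+-cancelˡ-≡ (x2 ℕ.+ x3) _ _ (trans (rearrange x1 x2 x3 x4) (trans total (sym (ℕP.+-assoc x2 x3 _))))
    where
    rearrange : ∀ a b c d → (b ℕ.+ c) ℕ.+ (a ℕ.+ d) ≡ a ℕ.+ (b ℕ.+ (c ℕ.+ d))
    rearrange = NS.solve-∀

  regroup : ∀ (i1a i1b i1p i1r i2a i2b i2p i2r i3a i3b i3p i3r i4a i4b i4p i4r ba bb bp br : ℚ) →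
    ((i1a * (i2b * (i3p * i4r)) + ((i3p * i4r) * bb + ((i2a * i4r) * bp + (i2a * i3b) * br)) + - ((i3p * i4r) * ba + ((i2a * i4r) * bb + (i2a * i3b) * bp))) + ((i1a * (i2p * (i3b * i4r)) + ((i3b * i4r) * bp + ((i2a * i4r) * bb + (i2a * i3p) * br)) + - ((i3b * i4r) * ba + ((i2a * i4r) * bp + (i2a * i3p) * bb))) + ((i1a * (i2p * (i3r * i4b)) + ((i3r * i4b) * bp + ((i2a * i4b) * br + (i2a * i3p) * bb)) + - ((i3r * i4b) * ba + ((i2a * i4b) * bp + (i2a * i3p) * br))) + ((i1p * (i2a * (i3b * i4r)) + ((i3b * i4r) * ba + ((i2p * i4r) * bb + (i2p * i3a) * br)) + - ((i3b * i4r) * bp + ((i2p * i4r) * ba + (i2p * i3a) * bb))) + ((i1p * (i2a * (i3r * i4b)) + ((i3r * i4b) * ba + ((i2p * i4b) * br + (i2p * i3a) * bb)) + - ((i3r * i4b) * bp + ((i2p * i4b) * ba + (i2p * i3a) * br))) + ((i1p * (i2r * (i3a * i4b)) + ((i3a * i4b) * br + ((i2p * i4b) * ba + (i2p * i3r) * bb)) + - ((i3a * i4b) * bp + ((i2p * i4b) * br + (i2p * i3r) * ba))) + 0ℚ))))))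
    ≡ (i1p * i4r + br + - bp) * (i2a * i3b) + ((i1p * i3r + br + - bp) * (i2a * i4b) + (i1p * i2r + br + - bp) * (i3a * i4b)) + (i3p * (i4r * (i1a * i2b + bb + - ba)) + (i2p * (i4r * (i1a * i3b + bb + - ba)) + i2p * (i3r * (i1a * i4b + bb + - ba))))
  regroup = solve-∀ ℚ-ring

  Σ-shuffle : Σ[ shuffle m' (suc r1 ∷ suc r2 ∷ []) ] (λ w → ecoef n w) ≡ leadingTerms + pairDeleted
  Σ-shuffle = trans (cong₂ _+_ w₁ (cong₂ _+_ w₂ (cong₂ _+_ w₃ (cong₂ _+_ w₄ (cong₂ _+_ w₅ (cong (_+ 0ℚ) w₆))))))
    (trans (regroup (δℕ x1 y1) (δℕ x1 y2) (δℕ x1 r1) (δℕ x1 r2) (δℕ x2 y1) (δℕ x2 y2) (δℕ x2 r1) (δℕ x2 r2)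
                    (δℕ x3 y1) (δℕ x3 y2) (δℕ x3 r1) (δℕ x3 r2) (δℕ x4 y1) (δℕ x4 y2) (δℕ x4 r1) (δℕ x4 r2)
                    (binom x1 y1) (binom x1 y2) (binom x1 r1) (binom x1 r2))
      (sym (cong (leadingTerms +_)
        (cong₂ _+_ (𝟙-*-cong (x3 ℕ.≟ r1) (λ e → 𝟙-*-cong (x4 ℕ.≟ r2) (λ e' → ClosedForm₂.ecoef≡closedForm x1 x2 y1 y2 e1 e2 f1 f2 (degree-without₃₄ e e'))))
          (cong₂ _+_ (𝟙-*-cong (x2 ℕ.≟ r1) (λ e → 𝟙-*-cong (x4 ℕ.≟ r2) (λ e' → ClosedForm₂.ecoef≡closedForm x1 x3 y1 y2 e1 e3 f1 f2 (degree-without₂₄ e e'))))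
                     (𝟙-*-cong (x2 ℕ.≟ r1) (λ e → 𝟙-*-cong (x3 ℕ.≟ r2) (λ e' → ClosedForm₂.ecoef≡closedForm x1 x4 y1 y2 e1 e4 f1 f2 (degree-without₂₃ e e')))))))))
    where
    rearrange₁ : ∀ a b p r → p ℕ.+ (r ℕ.+ (a ℕ.+ b)) ≡ a ℕ.+ (b ℕ.+ (p ℕ.+ r))
    rearrange₁ = NS.solve-∀
    rearrange₂ : ∀ a b p r → p ℕ.+ (r ℕ.+ (a ℕ.+ b)) ≡ a ℕ.+ (p ℕ.+ (b ℕ.+ r))
    rearrange₂ = NS.solve-∀
    rearrange₃ : ∀ a b p r → p ℕ.+ (r ℕ.+ (a ℕ.+ b)) ≡ a ℕ.+ (p ℕ.+ (r ℕ.+ b))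
    rearrange₃ = NS.solve-∀
    rearrange₄ : ∀ a b p r → p ℕ.+ (r ℕ.+ (a ℕ.+ b)) ≡ p ℕ.+ (a ℕ.+ (b ℕ.+ r))
    rearrange₄ = NS.solve-∀
    rearrange₅ : ∀ a b p r → p ℕ.+ (r ℕ.+ (a ℕ.+ b)) ≡ p ℕ.+ (a ℕ.+ (r ℕ.+ b))
    rearrange₅ = NS.solve-∀
    w₁ = ClosedForm₄.ecoef≡closedForm x1 x2 x3 x4 y1 y2 r1 r2 e1 e2 e3 e4 f1 f2 g1 g2 (trans total (rearrange₁ y1 y2 r1 r2))
    w₂ = ClosedForm₄.ecoef≡closedForm x1 x2 x3 x4 y1 r1 y2 r2 e1 e2 e3 e4 f1 g1 f2 g2 (trans total (rearrange₂ y1 y2 r1 r2))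
    w₃ = ClosedForm₄.ecoef≡closedForm x1 x2 x3 x4 y1 r1 r2 y2 e1 e2 e3 e4 f1 g1 g2 f2 (trans total (rearrange₃ y1 y2 r1 r2))
    w₄ = ClosedForm₄.ecoef≡closedForm x1 x2 x3 x4 r1 y1 y2 r2 e1 e2 e3 e4 g1 f1 f2 g2 (trans total (rearrange₄ y1 y2 r1 r2))
    w₅ = ClosedForm₄.ecoef≡closedForm x1 x2 x3 x4 r1 y1 r2 y2 e1 e2 e3 e4 g1 f1 g2 f2 (trans total (rearrange₅ y1 y2 r1 r2))
    w₆ = ClosedForm₄.ecoef≡closedForm x1 x2 x3 x4 r1 r2 y1 y2 e1 e2 e3 e4 g1 g2 f1 f2 total

ker-term : ∀ M r (v : Vect) → InKer M r (ᵗ E) v → (x q : ℕ) (t : Tuple) → (x ≡ q → IsS M r t) →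
  δℕ x q * Σ[ S M r ] (λ m → v m * ecoef t m) ≡ 0ℚ
ker-term M r v v∈ker x q t h =
  trans (𝟙-*-cong (x ℕ.≟ q) {Σ[ S M r ] (λ m → v m * ecoef t m)} {0ℚ} (λ e → v∈ker t (IsS⇒∈S M r t (h e)))) (QP.*-zeroʳ (δℕ x q))

ker-term₂ : ∀ M r (v : Vect) → InKer M r (ᵗ E) v → (x q y q' : ℕ) (t : Tuple) → (x ≡ q → y ≡ q' → IsS M r t) →
  δℕ x q * (δℕ y q' * Σ[ S M r ] (λ m → v m * ecoef t m)) ≡ 0ℚ
ker-term₂ M r v v∈ker x q y q' t h =
  trans (𝟙-*-cong (x ℕ.≟ q) {δℕ y q' * Σ[ S M r ] (λ m → v m * ecoef t m)} {0ℚ} (λ e → ker-term M r v v∈ker y q' t (h e))) (QP.*-zeroʳ (δℕ x q))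

total-shift₄ : ∀ N p x1 x2 x3 x4 y1 y2 y3 q → p ≡ suc q → p ≤ N →
  suc x1 ℕ.+ (suc x2 ℕ.+ (suc x3 ℕ.+ (suc x4 ℕ.+ 0))) ≡ N → suc y1 ℕ.+ (suc y2 ℕ.+ (suc y3 ℕ.+ 0)) ≡ N ∸ p →
  x1 ℕ.+ (x2 ℕ.+ (x3 ℕ.+ x4)) ≡ q ℕ.+ (y1 ℕ.+ (y2 ℕ.+ y3))
total-shift₄ N p x1 x2 x3 x4 y1 y2 y3 q refl p≤ sx sy =
  ℕP.+-cancelˡ-≡ 4 _ _ (trans (expand x1 x2 x3 x4) (trans sx (trans (sym (ℕP.m∸n+n≡m p≤)) (trans (cong (ℕ._+ suc q) (sym sy)) (collect y1 y2 y3 q)))))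
  where
  expand : ∀ a b c d → 4 ℕ.+ (a ℕ.+ (b ℕ.+ (c ℕ.+ d))) ≡ suc a ℕ.+ (suc b ℕ.+ (suc c ℕ.+ (suc d ℕ.+ 0)))
  expand = NS.solve-∀
  collect : ∀ a b c q → suc a ℕ.+ (suc b ℕ.+ (suc c ℕ.+ 0)) ℕ.+ suc q ≡ 4 ℕ.+ (q ℕ.+ (a ℕ.+ (b ℕ.+ c)))
  collect = NS.solve-∀

Ψ-ᵗE≈Φ₄ : ∀ N p → Odd p → 3 ≤ p → (v : Vect) → InKer (N ∸ p) 3 (ᵗ E) v →
  act N 4 (Ψ (N ∸ p) 3 (p ∷ []) v) (ᵗ E) ≈[ N , 4 ] Φ (p ∷ []) v
Ψ-ᵗE≈Φ₄ N (suc q) op (s≤s q≥2) v v∈ker n n∈ = at n (∈S⇒IsS N 4 n n∈)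
  where
  p = suc q
  M = N ∸ p
  eq : IsEven q
  eq = odd⇒pred-even q op
  shuffles-in-S : ∀ m' → m' ∈ S M 3 → All (IsS N 4) (shuffle m' (p ∷ []))
  shuffles-in-S m' m'∈ = shuffle-IsS M 3 p 1 N m' (p ∷ []) ism (IsS-singleton p (op , s≤s q≥2)) (ℕP.m∸n+n≡m (IsS-∸⇒≤ N p 2 m' ism))
    where ism = ∈S⇒IsS M 3 m' m'∈
  at : ∀ n → IsS N 4 n → act N 4 (Ψ M 3 (p ∷ []) v) (ᵗ E) n ≡ Φ (p ∷ []) v n
  at n@(suc x1 ∷ suc x2 ∷ suc x3 ∷ suc x4 ∷ []) isn@(refl , sn , (o1 , s≤s _) ∷ (o2 , s≤s _) ∷ (o3 , s≤s _) ∷ (o4 , s≤s _) ∷ []) = begin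
      act N 4 (Ψ M 3 (p ∷ []) v) (ᵗ E) n
        ≡⟨ act-Ψ N 4 M 3 (p ∷ []) v (ᵗ E) shuffles-in-S n ⟩
      Σ[ S M 3 ] (λ m' → v m' * Σ[ shuffle m' (p ∷ []) ] (λ w → ecoef n w))
        ≡⟨ Σ-cong (S M 3) (λ m' m'∈ → cong (v m' *_) (shuffle-identity m' (∈S⇒IsS M 3 m' m'∈))) ⟩
      Σ[ S M 3 ] (λ m' → v m' * (c * δ d m' + (i2 * ecoef n2 m' + (i3 * ecoef n3 m' + i4 * ecoef n4 m'))))
        ≡⟨ Σ-*-distrib₄ (S M 3) v (λ m' → c * δ d m') (λ m' → i2 * ecoef n2 m') (λ m' → i3 * ecoef n3 m') (λ m' → i4 * ecoef n4 m') ⟩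
      Σ[ S M 3 ] (λ m' → v m' * (c * δ d m')) + (Σ[ S M 3 ] (λ m' → v m' * (i2 * ecoef n2 m')) + (Σ[ S M 3 ] (λ m' → v m' * (i3 * ecoef n3 m')) + Σ[ S M 3 ] (λ m' → v m' * (i4 * ecoef n4 m'))))
        ≡⟨ cong₂ _+_ (trans (Σ-*-pull (S M 3) v (δ d) c) (𝟙-*-cong ((p ∷ []) ≟T (suc x1 ∷ [])) (λ e → Σ-S-δʳ M 3 d (IsS-delete [] (suc x1) (suc x2 ∷ suc x3 ∷ suc x4 ∷ []) (sym (LP.∷-injectiveˡ e)) isn) v)))
             (cong₂ _+_ (trans (Σ-*-pull (S M 3) v (ecoef n2) i2) (ker-term M 3 v v∈ker (suc x2) p n2 (λ e → IsS-delete (suc x1 ∷ []) (suc x2) (suc x3 ∷ suc x4 ∷ []) e isn)))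
               (cong₂ _+_ (trans (Σ-*-pull (S M 3) v (ecoef n3) i3) (ker-term M 3 v v∈ker (suc x3) p n3 (λ e → IsS-delete (suc x1 ∷ suc x2 ∷ []) (suc x3) (suc x4 ∷ []) e isn)))
                          (trans (Σ-*-pull (S M 3) v (ecoef n4) i4) (ker-term M 3 v v∈ker (suc x4) p n4 (λ e → IsS-delete (suc x1 ∷ suc x2 ∷ suc x3 ∷ []) (suc x4) [] e isn))))) ⟩
      c * v d + (0ℚ + (0ℚ + 0ℚ))
        ≡⟨ QP.+-identityʳ (c * v d) ⟩
      Φ (p ∷ []) v n ∎
    where
    open ≡-Reasoning
    c = δ (p ∷ []) (take 1 n)
    d = drop 1 n
    i2 = 𝟙 (does (suc x2 ℕ.≟ p))
    i3 = 𝟙 (does (suc x3 ℕ.≟ p))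
    i4 = 𝟙 (does (suc x4 ℕ.≟ p))
    n2 n3 n4 : Tuple
    n2 = suc x1 ∷ suc x3 ∷ suc x4 ∷ []
    n3 = suc x1 ∷ suc x2 ∷ suc x4 ∷ []
    n4 = suc x1 ∷ suc x2 ∷ suc x3 ∷ []
    shuffle-identity : ∀ m' → IsS M 3 m' → Σ[ shuffle m' (p ∷ []) ] (λ w → ecoef n w) ≡ c * δ d m' + (i2 * ecoef n2 m' + (i3 * ecoef n3 m' + i4 * ecoef n4 m'))
    shuffle-identity m'@(suc y1 ∷ suc y2 ∷ suc y3 ∷ []) ism@(refl , sm , (f1 , s≤s _) ∷ (f2 , s≤s _) ∷ (f3 , s≤s _) ∷ []) =
      ShuffleSingle₄.Σ-shuffle x1 x2 x3 x4 y1 y2 y3 q (odd⇒pred-even x1 o1) (odd⇒pred-even x2 o2) (odd⇒pred-even x3 o3) (odd⇒pred-even x4 o4) (odd⇒pred-even y1 f1) (odd⇒pred-even y2 f2) (odd⇒pred-even y3 f3) eq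
        (total-shift₄ N p x1 x2 x3 x4 y1 y2 y3 q refl (IsS-∸⇒≤ N p 2 m' ism) sn sm)

δ-move : ∀ (ps t a : Tuple) (X Y : ℚ) → (δ ps t * X) * (δ a t * Y) ≡ δ ps t * (X * (δ a ps * Y))
δ-move ps t a X Y with ps ≟T t
... | yes refl = QP.*-assoc 1ℚ X (δ a ps * Y)
... | no _ = trans (*≡0ˡ (0ℚ * X) (δ a t * Y) (QP.*-zeroˡ X)) (sym (QP.*-zeroˡ (X * (δ a ps * Y))))

δ-move₂ : ∀ (e : ℚ) (a b c : Tuple) (Y Z : ℚ) → (e * (δ a b * Y)) * (δ c b * Z) ≡ e * (δ a b * (Y * (δ c a * Z)))
δ-move₂ e a b c Y Z with a ≟T b
... | yes refl = regroup e Y (δ c a * Z)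
  where
  regroup : ∀ e Y Z → (e * (1ℚ * Y)) * Z ≡ e * (1ℚ * (Y * Z))
  regroup = solve-∀ ℚ-ring
... | no _ = trans (*≡0ˡ (e * (0ℚ * Y)) (δ c b * Z) (*≡0ʳ e (0ℚ * Y) (QP.*-zeroˡ Y))) (sym (*≡0ʳ e (0ℚ * (Y * (δ c a * Z))) (QP.*-zeroˡ (Y * (δ c a * Z)))))

-- For p > N the truncated difference N ∸ p is 0, and S 0 2 is empty.
Ψ-empty : ∀ N p (w : Tuple) (v : Vect) x → ¬ (p ≤ N) → Ψ (N ∸ p) 2 w v x ≡ 0ℚ
Ψ-empty N p w v x np rewrite ℕP.m≤n⇒m∸n≡0 (ℕP.≰⇒≥ np) = refl

act-0 : ∀ N' r (u : Vect) (M : Mat) y → (∀ x → u x ≡ 0ℚ) → act N' r u M y ≡ 0ℚ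
act-0 N' r u M y h = trans (Σ-cong (S N' r) (λ x _ → *≡0ˡ (u x) (M x y) (h x))) (Σ-0 (S N' r))

Φ∈ker-ᵗE⁽³⁾ : ∀ N p → Odd p → 3 ≤ p → (v : Vect) → InKer (N ∸ p) 3 (ᵗ E) v →
  InKer N 4 (ᵗ Eq 3 4) (Φ (p ∷ []) v)
Φ∈ker-ᵗE⁽³⁾ N p op p≥3 v v∈ker n n∈ = at n (∈S⇒IsS N 4 n n∈)
  where
  at : ∀ n → IsS N 4 n → act N 4 (Φ (p ∷ []) v) (ᵗ Eq 3 4) n ≡ 0ℚ
  at n@(x1 ∷ x2 ∷ x3 ∷ x4 ∷ []) isn = begin
      Σ[ S N 4 ] (λ m → (δ (p ∷ []) (take 1 m) * v (drop 1 m)) * (δ (take 1 n) (take 1 m) * ecoef (drop 1 n) (drop 1 m)))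
        ≡⟨ Σ-cong (S N 4) (λ m _ → δ-move (p ∷ []) (take 1 m) (take 1 n) (v (drop 1 m)) (ecoef (drop 1 n) (drop 1 m))) ⟩
      Σ[ S N 4 ] (λ m → δ (p ∷ []) (take 1 m) * f (drop 1 m))
        ≡⟨ Σ-S-δ-prefix N 1 2 (p ∷ []) refl ((op , p≥3) ∷ []) f ⟩
      Σ[ S (N ∸ (p ℕ.+ 0)) 3 ] f
        ≡⟨ cong (λ z → Σ[ S (N ∸ z) 3 ] f) (ℕP.+-identityʳ p) ⟩
      Σ[ S (N ∸ p) 3 ] f
        ≡⟨ Σ-*-pull (S (N ∸ p) 3) v (ecoef (drop 1 n)) c ⟩
      c * Σ[ S (N ∸ p) 3 ] (λ m → v m * ecoef (drop 1 n) m)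
        ≡⟨ trans (𝟙-*-cong (take 1 n ≟T (p ∷ [])) (λ e → v∈ker (drop 1 n) (IsS⇒∈S (N ∸ p) 3 (drop 1 n) (IsS-delete [] x1 (x2 ∷ x3 ∷ x4 ∷ []) (LP.∷-injectiveˡ e) isn)))) (QP.*-zeroʳ c) ⟩
      0ℚ ∎
    where
    open ≡-Reasoning
    c = δ (take 1 n) (p ∷ [])
    f : Tuple → ℚ
    f m'' = v m'' * (c * ecoef (drop 1 n) m'')

total-shift₃ : ∀ N' M x1 x2 x3 y1 y2 q → M ℕ.+ suc q ≡ N' →
  suc x1 ℕ.+ (suc x2 ℕ.+ (suc x3 ℕ.+ 0)) ≡ N' → suc y1 ℕ.+ (suc y2 ℕ.+ 0) ≡ M →
  x1 ℕ.+ (x2 ℕ.+ x3) ≡ q ℕ.+ (y1 ℕ.+ y2)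
total-shift₃ N' M x1 x2 x3 y1 y2 q Mq sx sy =
  ℕP.+-cancelˡ-≡ 3 _ _ (trans (expand x1 x2 x3) (trans sx (trans (sym Mq) (trans (cong (ℕ._+ suc q) (sym sy)) (collect y1 y2 q)))))
  where
  expand : ∀ a b c → 3 ℕ.+ (a ℕ.+ (b ℕ.+ c)) ≡ suc a ℕ.+ (suc b ℕ.+ (suc c ℕ.+ 0))
  expand = NS.solve-∀
  collect : ∀ a b q → suc a ℕ.+ (suc b ℕ.+ 0) ℕ.+ suc q ≡ 3 ℕ.+ (q ℕ.+ (a ℕ.+ b))
  collect = NS.solve-∀

Ψ-ᵗE≈Φ₃ : ∀ N' M q → Odd q → 3 ≤ q → M ℕ.+ q ≡ N' → (v : Vect) → InKer M 2 (ᵗ E) v →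
  ∀ n → IsS N' 3 n → act N' 3 (Ψ M 2 (q ∷ []) v) (ᵗ E) n ≡ Φ (q ∷ []) v n
Ψ-ᵗE≈Φ₃ N' M (suc q) oq (s≤s q≥2) Mq v v∈ker n@(suc x1 ∷ suc x2 ∷ suc x3 ∷ []) isn@(refl , sn , (o1 , s≤s _) ∷ (o2 , s≤s _) ∷ (o3 , s≤s _) ∷ []) = begin
      act N' 3 (Ψ M 2 (p ∷ []) v) (ᵗ E) n
        ≡⟨ act-Ψ N' 3 M 2 (p ∷ []) v (ᵗ E) shuffles-in-S n ⟩
      Σ[ S M 2 ] (λ m' → v m' * Σ[ shuffle m' (p ∷ []) ] (λ w → ecoef n w))
        ≡⟨ Σ-cong (S M 2) (λ m' m'∈ → cong (v m' *_) (shuffle-identity m' (∈S⇒IsS M 2 m' m'∈))) ⟩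
      Σ[ S M 2 ] (λ m' → v m' * (c * δ d m' + (i2 * ecoef n2 m' + i3 * ecoef n3 m')))
        ≡⟨ Σ-*-distrib₃ (S M 2) v (λ m' → c * δ d m') (λ m' → i2 * ecoef n2 m') (λ m' → i3 * ecoef n3 m') ⟩
      Σ[ S M 2 ] (λ m' → v m' * (c * δ d m')) + (Σ[ S M 2 ] (λ m' → v m' * (i2 * ecoef n2 m')) + Σ[ S M 2 ] (λ m' → v m' * (i3 * ecoef n3 m')))
        ≡⟨ cong₂ _+_ (trans (Σ-*-pull (S M 2) v (δ d) c) (𝟙-*-cong ((p ∷ []) ≟T (suc x1 ∷ [])) (λ e → Σ-S-δʳ M 2 d (delete [] (suc x1) (suc x2 ∷ suc x3 ∷ []) isn (sym (LP.∷-injectiveˡ e))) v)))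
             (cong₂ _+_ (trans (Σ-*-pull (S M 2) v (ecoef n2) i2) (ker-term M 2 v v∈ker (suc x2) p n2 (delete (suc x1 ∷ []) (suc x2) (suc x3 ∷ []) isn)))
                        (trans (Σ-*-pull (S M 2) v (ecoef n3) i3) (ker-term M 2 v v∈ker (suc x3) p n3 (delete (suc x1 ∷ suc x2 ∷ []) (suc x3) [] isn)))) ⟩
      c * v d + (0ℚ + 0ℚ)
        ≡⟨ QP.+-identityʳ (c * v d) ⟩
      Φ (p ∷ []) v n ∎
  where
  open ≡-Reasoning
  p = suc q
  shuffles-in-S : ∀ m' → m' ∈ S M 2 → All (IsS N' 3) (shuffle m' (p ∷ []))
  shuffles-in-S m' m'∈ = shuffle-IsS M 2 p 1 N' m' (p ∷ []) (∈S⇒IsS M 2 m' m'∈) (IsS-singleton p (oq , s≤s q≥2)) Mq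
  delete : ∀ xs y ys → IsS N' 3 (xs ++ y ∷ ys) → y ≡ p → IsS M 2 (xs ++ ys)
  delete xs y ys isS e = subst (λ K → IsS K 2 (xs ++ ys)) (sym (m+n≡o⇒m≡o∸n M p N' Mq)) (IsS-delete xs y ys e isS)
  c = δ (p ∷ []) (take 1 n)
  d = drop 1 n
  i2 = 𝟙 (does (suc x2 ℕ.≟ p))
  i3 = 𝟙 (does (suc x3 ℕ.≟ p))
  n2 n3 : Tuple
  n2 = suc x1 ∷ suc x3 ∷ []
  n3 = suc x1 ∷ suc x2 ∷ []
  shuffle-identity : ∀ m' → IsS M 2 m' → Σ[ shuffle m' (p ∷ []) ] (λ w → ecoef n w) ≡ c * δ d m' + (i2 * ecoef n2 m' + i3 * ecoef n3 m')
  shuffle-identity m'@(suc y1 ∷ suc y2 ∷ []) ism@(refl , sm , (f1 , s≤s _) ∷ (f2 , s≤s _) ∷ []) =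
    ShuffleSingle₃.Σ-shuffle x1 x2 x3 y1 y2 q (odd⇒pred-even x1 o1) (odd⇒pred-even x2 o2) (odd⇒pred-even x3 o3) (odd⇒pred-even y1 f1) (odd⇒pred-even y2 f2) (odd⇒pred-even q oq)
      (total-shift₃ N' M x1 x2 x3 y1 y2 q Mq sn sm)

δℕ²-*-cong : ∀ a b c d (X Y : ℚ) → (a ≡ b → c ≡ d → X ≡ Y) → (δℕ a b * δℕ c d) * X ≡ (δℕ a b * δℕ c d) * Y
δℕ²-*-cong a b c d X Y h = trans (QP.*-assoc (δℕ a b) (δℕ c d) X)
  (trans (𝟙-*-cong (a ℕ.≟ b) (λ e → 𝟙-*-cong (c ℕ.≟ d) (h e))) (sym (QP.*-assoc (δℕ a b) (δℕ c d) Y)))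

-- The leading terms of ShufflePair₄ regrouped over t ∈ S_{p,2}: F t is e(t ; r₁r₂) times the coefficient of n in
-- the word t₁ · (m′ ш t₂), which is what Φ_{t₁} ∘ Ψ_{t₂} contributes on the basis vector m′.
module LeadingTerms (x1 x2 x3 x4 y1 y2 r1 r2 : ℕ)
  (e1 : IsEven x1) (e2 : IsEven x2) (e3 : IsEven x3) (e4 : IsEven x4) (f1 : IsEven y1) (f2 : IsEven y2) (g1 : IsEven r1) (g2 : IsEven r2)
  (P : x1 ℕ.+ (x2 ℕ.+ (x3 ℕ.+ x4)) ≡ r1 ℕ.+ (r2 ℕ.+ (y1 ℕ.+ y2)))
  (ox : All OddGe3 (suc x1 ∷ suc x2 ∷ suc x3 ∷ suc x4 ∷ []))
  (p : ℕ) (pe : suc r1 ℕ.+ (suc r2 ℕ.+ 0) ≡ p) where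

  pp : Tuple
  pp = suc r1 ∷ suc r2 ∷ []
  et : Tuple → ℚ
  et t = ecoef t pp
  m1 mr : Tuple
  m1 = suc x1 ∷ []
  mr = suc x2 ∷ suc x3 ∷ suc x4 ∷ []
  u1 u2 u3 : Tuple
  u1 = suc x1 ∷ suc x4 ∷ []
  u2 = suc x1 ∷ suc x3 ∷ []
  u3 = suc x1 ∷ suc x2 ∷ []
  A1 A2 A3 : ℚ
  A1 = δℕ y1 x2 * δℕ y2 x3
  A2 = δℕ y1 x2 * δℕ y2 x4
  A3 = δℕ y1 x3 * δℕ y2 x4

  F : Tuple → ℚ
  F t = et t * (δ (take 1 t) m1 * count mr (shuffle (suc y1 ∷ suc y2 ∷ []) (drop 1 t)))

  F-expand : ∀ t → IsS p 2 t → F t ≡ A1 * (δ u1 t * et t) + (A2 * (δ u2 t * et t) + A3 * (δ u3 t * et t))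
  F-expand t@(suc t1 ∷ suc t2 ∷ []) (refl , _ , (_ , s≤s _) ∷ (_ , s≤s _) ∷ []) =
    trans (cong (et t *_) (cong₂ _*_ (δ-∷₁′ (suc t1) (suc x1))
             (cong₂ _+_ (trans (δ-∷₃ (suc y1) (suc y2) (suc t2) (suc x2) (suc x3) (suc x4)) (cong (λ z → δℕ y1 x2 * (δℕ y2 x3 * (z * 1ℚ))) (δℕ-sym t2 x4)))
               (cong₂ _+_ (trans (δ-∷₃ (suc y1) (suc t2) (suc y2) (suc x2) (suc x3) (suc x4)) (cong (λ z → δℕ y1 x2 * (z * (δℕ y2 x4 * 1ℚ))) (δℕ-sym t2 x3)))
                 (cong (_+ 0ℚ) (trans (δ-∷₃ (suc t2) (suc y1) (suc y2) (suc x2) (suc x3) (suc x4)) (cong (λ z → z * (δℕ y1 x3 * (δℕ y2 x4 * 1ℚ))) (δℕ-sym t2 x2))))))))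
    (trans (regroup (et t) (δℕ x1 t1) (δℕ y1 x2) (δℕ y2 x3) (δℕ x4 t2) (δℕ x3 t2) (δℕ y2 x4) (δℕ x2 t2) (δℕ y1 x3))
      (sym (cong₂ _+_ (cong (λ z → A1 * (z * et t)) (δ-∷₂ (suc x1) (suc x4) (suc t1) (suc t2)))
             (cong₂ _+_ (cong (λ z → A2 * (z * et t)) (δ-∷₂ (suc x1) (suc x3) (suc t1) (suc t2)))
                        (cong (λ z → A3 * (z * et t)) (δ-∷₂ (suc x1) (suc x2) (suc t1) (suc t2)))))))
    where
    regroup : ∀ (e a1 b2a b3b t4 t3 b4b t2 b3a : ℚ) →
      e * ((a1 * 1ℚ) * (b2a * (b3b * (t4 * 1ℚ)) + (b2a * (t3 * (b4b * 1ℚ)) + (t2 * (b3a * (b4b * 1ℚ)) + 0ℚ)))) ≡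
      (b2a * b3b) * ((a1 * (t4 * 1ℚ)) * e) + ((b2a * b4b) * ((a1 * (t3 * 1ℚ)) * e) + (b3a * b4b) * ((a1 * (t2 * 1ℚ)) * e))
    regroup = solve-∀ ℚ-ring

  rearrange : ∀ a b c d → a ℕ.+ (b ℕ.+ (c ℕ.+ d)) ≡ (a ℕ.+ d) ℕ.+ (b ℕ.+ c)
  rearrange = NS.solve-∀
  rearrange′ : ∀ a b c d → a ℕ.+ (b ℕ.+ (c ℕ.+ d)) ≡ (a ℕ.+ b) ℕ.+ (c ℕ.+ d)
  rearrange′ = NS.solve-∀
  degree₁ : y1 ≡ x2 → y2 ≡ x3 → x1 ℕ.+ x4 ≡ r1 ℕ.+ r2
  degree₁ refl refl = ℕP.+-cancelʳ-≡ (y1 ℕ.+ y2) _ _ (trans (sym (rearrange x1 y1 y2 x4)) (trans P (rearrange′ r1 r2 y1 y2)))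
  degree₂ : y1 ≡ x2 → y2 ≡ x4 → x1 ℕ.+ x3 ≡ r1 ℕ.+ r2
  degree₂ refl refl = ℕP.+-cancelʳ-≡ (y1 ℕ.+ y2) _ _ (trans (sym (r x1 y1 x3 y2)) (trans P (rearrange′ r1 r2 y1 y2)))
    where r : ∀ a b c d → a ℕ.+ (b ℕ.+ (c ℕ.+ d)) ≡ (a ℕ.+ c) ℕ.+ (b ℕ.+ d)
          r = NS.solve-∀
  degree₃ : y1 ≡ x3 → y2 ≡ x4 → x1 ℕ.+ x2 ≡ r1 ℕ.+ r2
  degree₃ refl refl = ℕP.+-cancelʳ-≡ (y1 ℕ.+ y2) _ _ (trans (sym (rearrange′ x1 x2 y1 y2)) (trans P (rearrange′ r1 r2 y1 y2)))

  IsS-pair : ∀ a b → IsEven a → IsEven b → OddGe3 (suc a) → OddGe3 (suc b) → a ℕ.+ b ≡ r1 ℕ.+ r2 → IsS p 2 (suc a ∷ suc b ∷ [])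
  IsS-pair a b _ _ oa ob e = refl , trans (r a b) (trans (cong (λ z → suc (suc z)) e) (trans (sym (r r1 r2)) pe)) , oa ∷ ob ∷ []
    where r : ∀ a b → suc a ℕ.+ (suc b ℕ.+ 0) ≡ suc (suc (a ℕ.+ b))
          r = NS.solve-∀

  o1 = All.lookup ox (here refl)
  oo : All OddGe3 (suc x1 ∷ suc x2 ∷ suc x3 ∷ suc x4 ∷ []) → OddGe3 (suc x2) × OddGe3 (suc x3) × OddGe3 (suc x4)
  oo (_ ∷ a ∷ b ∷ c ∷ []) = a , b , c

  cf2' : ℕ → ℚ
  cf2' z = ClosedForm₂.closedForm x1 z r1 r2

  leadingTerms≡Σ : ShufflePair₄.leadingTerms x1 x2 x3 x4 y1 y2 r1 r2 e1 e2 e3 e4 f1 f2 g1 g2 P ≡ Σ[ S p 2 ] F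
  leadingTerms≡Σ = sym (begin
    Σ[ S p 2 ] F
      ≡⟨ Σ-cong (S p 2) (λ t t∈ → F-expand t (∈S⇒IsS p 2 t t∈)) ⟩
    Σ[ S p 2 ] (λ t → A1 * (δ u1 t * et t) + (A2 * (δ u2 t * et t) + A3 * (δ u3 t * et t)))
      ≡⟨ Σ-linear₃ (S p 2) A1 A2 A3 (λ t → δ u1 t * et t) (λ t → δ u2 t * et t) (λ t → δ u3 t * et t) ⟩
    A1 * Σ[ S p 2 ] (λ t → δ u1 t * et t) + (A2 * Σ[ S p 2 ] (λ t → δ u2 t * et t) + A3 * Σ[ S p 2 ] (λ t → δ u3 t * et t))
      ≡⟨ cong₂ _+_ (δℕ²-*-cong y1 x2 y2 x3 _ _ (λ a b → trans (Σ-S-δ p 2 u1 (IsS-pair x1 x4 e1 e4 o1 (proj₂ (proj₂ (oo ox))) (degree₁ a b)) et) (ClosedForm₂.ecoef≡closedForm x1 x4 r1 r2 e1 e4 g1 g2 (degree₁ a b))))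
           (cong₂ _+_ (δℕ²-*-cong y1 x2 y2 x4 _ _ (λ a b → trans (Σ-S-δ p 2 u2 (IsS-pair x1 x3 e1 e3 o1 (proj₁ (proj₂ (oo ox))) (degree₂ a b)) et) (ClosedForm₂.ecoef≡closedForm x1 x3 r1 r2 e1 e3 g1 g2 (degree₂ a b))))
                      (δℕ²-*-cong y1 x3 y2 x4 _ _ (λ a b → trans (Σ-S-δ p 2 u3 (IsS-pair x1 x2 e1 e2 o1 (proj₁ (oo ox)) (degree₃ a b)) et) (ClosedForm₂.ecoef≡closedForm x1 x2 r1 r2 e1 e2 g1 g2 (degree₃ a b))))) ⟩
    A1 * cf2' x4 + (A2 * cf2' x3 + A3 * cf2' x2)
      ≡⟨ trans (cong₂ (λ a b → (a * δℕ y2 x3) * cf2' x4 + ((a * b) * cf2' x3 + (δℕ y1 x3 * b) * cf2' x2)) (δℕ-sym y1 x2) (δℕ-sym y2 x4))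
           (trans (cong₂ (λ a b → (δℕ x2 y1 * a) * cf2' x4 + ((δℕ x2 y1 * δℕ x4 y2) * cf2' x3 + (b * δℕ x4 y2) * cf2' x2)) (δℕ-sym y2 x3) (δℕ-sym y1 x3))
             (commute (cf2' x4) (cf2' x3) (cf2' x2) (δℕ x2 y1) (δℕ x3 y2) (δℕ x4 y2) (δℕ x3 y1))) ⟩
    ShufflePair₄.leadingTerms x1 x2 x3 x4 y1 y2 r1 r2 e1 e2 e3 e4 f1 f2 g1 g2 P ∎)
    where
    open ≡-Reasoning
    commute : ∀ (c1 c2 c3 j2a j3b j4b j3a : ℚ) → (j2a * j3b) * c1 + ((j2a * j4b) * c2 + (j3a * j4b) * c3)
      ≡ c1 * (j2a * j3b) + (c2 * (j2a * j4b) + c3 * (j3a * j4b))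
    commute = solve-∀ ℚ-ring

total-shift₂ : ∀ N p x1 x2 x3 x4 y1 y2 r1 r2 → suc r1 ℕ.+ (suc r2 ℕ.+ 0) ≡ p → p ≤ N →
  suc x1 ℕ.+ (suc x2 ℕ.+ (suc x3 ℕ.+ (suc x4 ℕ.+ 0))) ≡ N → suc y1 ℕ.+ (suc y2 ℕ.+ 0) ≡ N ∸ p →
  x1 ℕ.+ (x2 ℕ.+ (x3 ℕ.+ x4)) ≡ r1 ℕ.+ (r2 ℕ.+ (y1 ℕ.+ y2))
total-shift₂ N p x1 x2 x3 x4 y1 y2 r1 r2 pe p≤ sx sy =
  ℕP.+-cancelˡ-≡ 4 _ _ (trans (r1' x1 x2 x3 x4) (trans sx (trans (sym (ℕP.m∸n+n≡m p≤)) (trans (cong₂ ℕ._+_ (sym sy) (sym pe)) (r2' y1 y2 r1 r2)))))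
  where
  r1' : ∀ a b c d → 4 ℕ.+ (a ℕ.+ (b ℕ.+ (c ℕ.+ d))) ≡ suc a ℕ.+ (suc b ℕ.+ (suc c ℕ.+ (suc d ℕ.+ 0)))
  r1' = NS.solve-∀
  r2' : ∀ a b r s → suc a ℕ.+ (suc b ℕ.+ 0) ℕ.+ (suc r ℕ.+ (suc s ℕ.+ 0)) ≡ 4 ℕ.+ (r ℕ.+ (s ℕ.+ (a ℕ.+ b)))
  r2' = NS.solve-∀

Ψ₂-ᵗE-expand : ∀ N p p1 p2 → IsS p 2 (p1 ∷ p2 ∷ []) → (v : Vect) → InKer (N ∸ p) 2 (ᵗ E) v →
  ∀ m → IsS N 4 m → act N 4 (Ψ (N ∸ p) 2 (p1 ∷ p2 ∷ []) v) (ᵗ E) m ≡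
       Σ[ S p 2 ] (λ t → ecoef t (p1 ∷ p2 ∷ []) * (δ (take 1 t) (take 1 m) * Ψ (N ∸ p) 2 (drop 1 t) v (drop 1 m)))
Ψ₂-ᵗE-expand N p (suc r1) (suc r2) isp@(refl , pe , (q1 , s≤s _) ∷ (q2 , s≤s _) ∷ []) v v∈ker
   m@(suc x1 ∷ suc x2 ∷ suc x3 ∷ suc x4 ∷ []) ism@(refl , sm , ox@((o1 , l1@(s≤s _)) ∷ (o2 , l2@(s≤s _)) ∷ (o3 , l3@(s≤s _)) ∷ (o4 , l4@(s≤s _)) ∷ [])) = begin
      act N 4 (Ψ M 2 pp' v) (ᵗ E) m
        ≡⟨ act-Ψ N 4 M 2 pp' v (ᵗ E) shuffles-in-S m ⟩
      Σ[ S M 2 ] (λ m' → v m' * Σ[ shuffle m' pp' ] (λ w → ecoef m w))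
        ≡⟨ Σ-cong (S M 2) (λ m' m'∈ → cong (v m' *_) (shuffle-identity m' (∈S⇒IsS M 2 m' m'∈))) ⟩
      Σ[ S M 2 ] (λ m' → v m' * (Σ[ S p 2 ] (λ t → F' t m') + kerF m'))
        ≡⟨ trans (Σ-cong (S M 2) (λ m' _ → QP.*-distribˡ-+ (v m') (Σ[ S p 2 ] (λ t → F' t m')) (kerF m'))) (Σ-+ (S M 2) (λ m' → v m' * Σ[ S p 2 ] (λ t → F' t m')) (λ m' → v m' * kerF m')) ⟩
      Σ[ S M 2 ] (λ m' → v m' * Σ[ S p 2 ] (λ t → F' t m')) + Σ[ S M 2 ] (λ m' → v m' * kerF m')
        ≡⟨ cong (Σ[ S M 2 ] (λ m' → v m' * Σ[ S p 2 ] (λ t → F' t m')) +_) (trans (Σ-*-distrib₃ (S M 2) v (λ m' → δℕ x3 r1 * (δℕ x4 r2 * ecoef n12 m')) (λ m' → δℕ x2 r1 * (δℕ x4 r2 * ecoef n13 m')) (λ m' → δℕ x2 r1 * (δℕ x3 r2 * ecoef n14 m')))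
             (trans (cong₂ _+_ (trans (Σ-*-pull₂ (S M 2) v (ecoef n12) (δℕ x3 r1) (δℕ x4 r2)) (ker-term₂ M 2 v v∈ker (suc x3) (suc r1) (suc x4) (suc r2) n12 d12))
                     (cong₂ _+_ (trans (Σ-*-pull₂ (S M 2) v (ecoef n13) (δℕ x2 r1) (δℕ x4 r2)) (ker-term₂ M 2 v v∈ker (suc x2) (suc r1) (suc x4) (suc r2) n13 d13))
                                (trans (Σ-*-pull₂ (S M 2) v (ecoef n14) (δℕ x2 r1) (δℕ x3 r2)) (ker-term₂ M 2 v v∈ker (suc x2) (suc r1) (suc x3) (suc r2) n14 d14))))
               (QP.+-identityʳ 0ℚ))) ⟩
      Σ[ S M 2 ] (λ m' → v m' * Σ[ S p 2 ] (λ t → F' t m')) + 0ℚ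
        ≡⟨ QP.+-identityʳ _ ⟩
      Σ[ S M 2 ] (λ m' → v m' * Σ[ S p 2 ] (λ t → F' t m'))
        ≡⟨ trans (Σ-cong (S M 2) (λ m' _ → sym (Σ-*ˡ (S p 2) (v m') (λ t → F' t m')))) (Σ-swap (S M 2) (S p 2) (λ m' t → v m' * F' t m')) ⟩
      Σ[ S p 2 ] (λ t → Σ[ S M 2 ] (λ m' → v m' * F' t m'))
        ≡⟨ Σ-cong (S p 2) (λ t _ → trans (Σ-cong (S M 2) (λ m' _ → sw (v m') (ecoef t pp') (δ (take 1 t) (take 1 m)) (count (drop 1 m) (shuffle m' (drop 1 t)))))
              (trans (Σ-*ˡ (S M 2) (ecoef t pp' * δ (take 1 t) (take 1 m)) (λ m' → v m' * count (drop 1 m) (shuffle m' (drop 1 t)))) (QP.*-assoc (ecoef t pp') (δ (take 1 t) (take 1 m)) (Ψ M 2 (drop 1 t) v (drop 1 m))))) ⟩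
      Σ[ S p 2 ] (λ t → ecoef t pp' * (δ (take 1 t) (take 1 m) * Ψ M 2 (drop 1 t) v (drop 1 m))) ∎
    where
    open ≡-Reasoning
    M = N ∸ p
    pp' : Tuple
    pp' = suc r1 ∷ suc r2 ∷ []
    shuffles-in-S : ∀ m' → m' ∈ S M 2 → All (IsS N 4) (shuffle m' pp')
    shuffles-in-S m' m'∈ = shuffle-IsS M 2 p 2 N m' pp' ism' isp (ℕP.m∸n+n≡m (IsS-∸⇒≤ N p 1 m' ism'))
      where ism' = ∈S⇒IsS M 2 m' m'∈
    F' : Tuple → Tuple → ℚ
    F' t m' = ecoef t pp' * (δ (take 1 t) (take 1 m) * count (drop 1 m) (shuffle m' (drop 1 t)))
    sw : ∀ v e d c → v * (e * (d * c)) ≡ (e * d) * (v * c)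
    sw = solve-∀ ℚ-ring
    n12 n13 n14 : Tuple
    n12 = suc x1 ∷ suc x2 ∷ []
    n13 = suc x1 ∷ suc x3 ∷ []
    n14 = suc x1 ∷ suc x4 ∷ []
    kerF : Tuple → ℚ
    kerF m' = δℕ x3 r1 * (δℕ x4 r2 * ecoef n12 m') + (δℕ x2 r1 * (δℕ x4 r2 * ecoef n13 m') + δℕ x2 r1 * (δℕ x3 r2 * ecoef n14 m'))
    ps = suc r1 ℕ.+ (suc r2 ℕ.+ 0)
    d12 : suc x3 ≡ suc r1 → suc x4 ≡ suc r2 → IsS M 2 n12
    d12 e3 e4 = IsS-∸-pair (suc r1) (suc r2) p pe
      (IsS-delete (suc x1 ∷ suc x2 ∷ []) (suc x4) [] e4 (IsS-delete (suc x1 ∷ suc x2 ∷ []) (suc x3) (suc x4 ∷ []) e3 ism))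
    d13 : suc x2 ≡ suc r1 → suc x4 ≡ suc r2 → IsS M 2 n13
    d13 e2 e4 = IsS-∸-pair (suc r1) (suc r2) p pe
      (IsS-delete (suc x1 ∷ suc x3 ∷ []) (suc x4) [] e4 (IsS-delete (suc x1 ∷ []) (suc x2) (suc x3 ∷ suc x4 ∷ []) e2 ism))
    d14 : suc x2 ≡ suc r1 → suc x3 ≡ suc r2 → IsS M 2 n14
    d14 e2 e3 = IsS-∸-pair (suc r1) (suc r2) p pe
      (IsS-delete (suc x1 ∷ []) (suc x3) (suc x4 ∷ []) e3 (IsS-delete (suc x1 ∷ []) (suc x2) (suc x3 ∷ suc x4 ∷ []) e2 ism))
    shuffle-identity : ∀ m' → IsS M 2 m' → Σ[ shuffle m' pp' ] (λ w → ecoef m w) ≡ Σ[ S p 2 ] (λ t → F' t m') + kerF m'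
    shuffle-identity m'@(suc y1 ∷ suc y2 ∷ []) ism'@(refl , sy , (f1 , s≤s _) ∷ (f2 , s≤s _) ∷ []) =
      trans (ShufflePair₄.Σ-shuffle x1 x2 x3 x4 y1 y2 r1 r2 e1 e2 e3 e4 (odd⇒pred-even y1 f1) (odd⇒pred-even y2 f2) g1 g2 P)
        (cong (_+ kerF m') (LeadingTerms.leadingTerms≡Σ x1 x2 x3 x4 y1 y2 r1 r2 e1 e2 e3 e4 (odd⇒pred-even y1 f1) (odd⇒pred-even y2 f2) g1 g2 P ox p pe))
      where
      e1 = odd⇒pred-even x1 o1 ; e2 = odd⇒pred-even x2 o2 ; e3 = odd⇒pred-even x3 o3 ; e4 = odd⇒pred-even x4 o4
      g1 = odd⇒pred-even r1 q1 ; g2 = odd⇒pred-even r2 q2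
      P = total-shift₂ N p x1 x2 x3 x4 y1 y2 r1 r2 pe (IsS-∸⇒≤ N p 1 m' ism') sm sy

module PartII (N p p1 p2 : ℕ) (isp : IsS p 2 (p1 ∷ p2 ∷ [])) (v : Vect) (v∈ker : InKer (N ∸ p) 2 (ᵗ E) v) where
  M = N ∸ p
  pp : Tuple
  pp = p1 ∷ p2 ∷ []
  X : Vect
  X = act N 4 (Ψ M 2 pp v) (ᵗ E)
  e : Tuple → ℚ
  e t = ecoef t pp

  Φ-Ψ-ᵗE⁽³⁾≈Φ : ∀ n → IsS N 4 n → ∀ t → IsS p 2 t →
    Σ[ S N 4 ] (λ m → δ (take 1 t) (take 1 m) * (Ψ M 2 (drop 1 t) v (drop 1 m) * (δ (take 1 n) (take 1 t) * ecoef (drop 1 n) (drop 1 m))))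
    ≡ Φ t v n
  Φ-Ψ-ᵗE⁽³⁾≈Φ n@(x1 ∷ x2 ∷ x3 ∷ x4 ∷ []) isn@(refl , sn , o1 ∷ o2 ∷ o3 ∷ o4 ∷ []) t@(t1 ∷ t2 ∷ []) (refl , st , ot1 ∷ ot2 ∷ []) = begin
      Σ[ S N 4 ] (λ m → δ (t1 ∷ []) (take 1 m) * f (drop 1 m))
        ≡⟨ Σ-S-δ-prefix N 1 2 (t1 ∷ []) refl (ot1 ∷ []) f ⟩
      Σ[ S (N ∸ (t1 ℕ.+ 0)) 3 ] f
        ≡⟨ Σ-*-pull (S (N ∸ (t1 ℕ.+ 0)) 3) (Ψ M 2 (t2 ∷ []) v) (ecoef (drop 1 n)) c ⟩
      c * act (N ∸ (t1 ℕ.+ 0)) 3 (Ψ M 2 (t2 ∷ []) v) (ᵗ E) (drop 1 n)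
        ≡⟨ 𝟙-*-cong ((x1 ∷ []) ≟T (t1 ∷ [])) step ⟩
      c * Φ (t2 ∷ []) v (drop 1 n)
        ≡⟨ merge-δ ⟩
      Φ t v n ∎
    where
    open ≡-Reasoning
    c = δ (x1 ∷ []) (t1 ∷ [])
    f : Tuple → ℚ
    f m'' = Ψ M 2 (t2 ∷ []) v m'' * (c * ecoef (drop 1 n) m'')
    N' = N ∸ (t1 ℕ.+ 0)
    isd : x1 ≡ t1 → IsS N' 3 (x2 ∷ x3 ∷ x4 ∷ [])
    isd e = subst (λ k → IsS (N ∸ k) 3 (x2 ∷ x3 ∷ x4 ∷ [])) (sym (ℕP.+-identityʳ t1)) (IsS-delete [] x1 (x2 ∷ x3 ∷ x4 ∷ []) e isn)
    step : x1 ∷ [] ≡ t1 ∷ [] → act N' 3 (Ψ M 2 (t2 ∷ []) v) (ᵗ E) (drop 1 n) ≡ Φ (t2 ∷ []) v (drop 1 n)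
    step eq with p ℕ.≤? N
    ... | yes p≤ = Ψ-ᵗE≈Φ₃ N' M t2 (proj₁ ot2) (proj₂ ot2) Mq v v∈ker (drop 1 n) (isd (LP.∷-injectiveˡ eq))
      where
      Mq : M ℕ.+ t2 ≡ N'
      Mq = (m+n≡o⇒m≡o∸n (M ℕ.+ t2) (t1 ℕ.+ 0) N (trans (r M t1 t2) (trans (cong (M ℕ.+_) st) (ℕP.m∸n+n≡m p≤))))
        where r : ∀ a b c → a ℕ.+ c ℕ.+ (b ℕ.+ 0) ≡ a ℕ.+ (b ℕ.+ (c ℕ.+ 0))
              r = NS.solve-∀
    ... | no np = trans (act-0 N' 3 (Ψ M 2 (t2 ∷ []) v) (ᵗ E) (drop 1 n) (λ x → Ψ-empty N p (t2 ∷ []) v x np))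
                    (sym (trans (cong (_* v (drop 1 (drop 1 n))) (δ-≢ (t2 ∷ []) (x2 ∷ []) ne)) (QP.*-zeroˡ (v (drop 1 (drop 1 n))))))
      where
      ne : t2 ∷ [] ≡ x2 ∷ [] → ⊥
      ne e2 = np (subst (ℕ._≤ N) (trans (cong₂ (λ a b → a ℕ.+ (b ℕ.+ 0)) (LP.∷-injectiveˡ eq) (sym (LP.∷-injectiveˡ e2))) st)
                   (subst ((x1 ℕ.+ (x2 ℕ.+ 0)) ℕ.≤_) sn (r x1 x2 x3 x4)))
        where r : ∀ a b c d → a ℕ.+ (b ℕ.+ 0) ℕ.≤ a ℕ.+ (b ℕ.+ (c ℕ.+ (d ℕ.+ 0)))
              r a b c d = ℕP.+-monoʳ-≤ a (ℕP.+-monoʳ-≤ b z≤n)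
    merge-δ : c * Φ (t2 ∷ []) v (drop 1 n) ≡ Φ t v n
    merge-δ = trans (cong (_* (δ (t2 ∷ []) (x2 ∷ []) * v (x3 ∷ x4 ∷ []))) (trans (δ-sym (x1 ∷ []) (t1 ∷ [])) (δ-∷ t1 x1 [] [])))
      (trans (r (δℕ t1 x1) (δ (t2 ∷ []) (x2 ∷ [])) (v (x3 ∷ x4 ∷ [])))
        (cong (_* v (x3 ∷ x4 ∷ [])) (sym (δ-∷ t1 x1 (t2 ∷ []) (x2 ∷ [])))))
      where r : ∀ i d V → (i * 1ℚ) * (d * V) ≡ (i * d) * V
            r = solve-∀ ℚ-ring

  Y : Tuple → Tuple → ℚ
  Y t m = Ψ M 2 (drop 1 t) v (drop 1 m)

  Ψ₂-ᵗE-ᵗE⁽³⁾≈lincomb : ∀ n → IsS N 4 n → act N 4 X (ᵗ Eq 3 4) n ≡ lincomb (S p 2) e (λ t → Φ t v) n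
  Ψ₂-ᵗE-ᵗE⁽³⁾≈lincomb n isn = begin
      Σ[ S N 4 ] (λ m → X m * H m)
        ≡⟨ Σ-cong (S N 4) (λ m m∈ → cong (_* H m) (Ψ₂-ᵗE-expand N p p1 p2 isp v v∈ker m (∈S⇒IsS N 4 m m∈))) ⟩
      Σ[ S N 4 ] (λ m → Σ[ S p 2 ] (λ t → e t * (δ (take 1 t) (take 1 m) * Y t m)) * H m)
        ≡⟨ Σ-cong (S N 4) (λ m _ → trans (sym (Σ-*ʳ (S p 2) (H m) (λ t → e t * (δ (take 1 t) (take 1 m) * Y t m))))
              (Σ-cong (S p 2) (λ t _ → δ-move₂ (e t) (take 1 t) (take 1 m) (take 1 n) (Y t m) (ecoef (drop 1 n) (drop 1 m))))) ⟩
      Σ[ S N 4 ] (λ m → Σ[ S p 2 ] (λ t → e t * G t m))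
        ≡⟨ Σ-swap (S N 4) (S p 2) (λ m t → e t * G t m) ⟩
      Σ[ S p 2 ] (λ t → Σ[ S N 4 ] (λ m → e t * G t m))
        ≡⟨ Σ-cong (S p 2) (λ t t∈ → trans (Σ-*ˡ (S N 4) (e t) (G t)) (cong (e t *_) (Φ-Ψ-ᵗE⁽³⁾≈Φ n isn t (∈S⇒IsS p 2 t t∈)))) ⟩
      Σ[ S p 2 ] (λ t → e t * Φ t v n) ∎
    where
    open ≡-Reasoning
    H : Tuple → ℚ
    H m = δ (take 1 n) (take 1 m) * ecoef (drop 1 n) (drop 1 m)
    G : Tuple → Tuple → ℚ
    G t m = δ (take 1 t) (take 1 m) * (Y t m * (δ (take 1 n) (take 1 t) * ecoef (drop 1 n) (drop 1 m)))

  W : Vect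
  W = act N 4 X (ᵗ Eq 3 4)

  lincomb∈ker-ᵗE⁽²⁾ : ∀ n → IsS N 4 n → act N 4 W (ᵗ Eq 2 4) n ≡ 0ℚ
  lincomb∈ker-ᵗE⁽²⁾ n isn = begin
      Σ[ S N 4 ] (λ m → W m * H m)
        ≡⟨ Σ-cong (S N 4) (λ m m∈ → cong (_* H m) (Ψ₂-ᵗE-ᵗE⁽³⁾≈lincomb m (∈S⇒IsS N 4 m m∈))) ⟩
      Σ[ S N 4 ] (λ m → Σ[ S p 2 ] (λ t → e t * Φ t v m) * H m)
        ≡⟨ Σ-cong (S N 4) (λ m _ → trans (sym (Σ-*ʳ (S p 2) (H m) (λ t → e t * Φ t v m)))
              (Σ-cong (S p 2) (λ t t∈ → mv t (∈S⇒IsS p 2 t t∈) m))) ⟩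
      Σ[ S N 4 ] (λ m → Σ[ S p 2 ] (λ t → e t * G t m))
        ≡⟨ Σ-swap (S N 4) (S p 2) (λ m t → e t * G t m) ⟩
      Σ[ S p 2 ] (λ t → Σ[ S N 4 ] (λ m → e t * G t m))
        ≡⟨ Σ-cong (S p 2) (λ t t∈ → trans (Σ-*ˡ (S N 4) (e t) (G t)) (cong (e t *_) (z t (∈S⇒IsS p 2 t t∈)))) ⟩
      Σ[ S p 2 ] (λ t → e t * 0ℚ)
        ≡⟨ trans (Σ-cong (S p 2) (λ t _ → QP.*-zeroʳ (e t))) (Σ-0 (S p 2)) ⟩
      0ℚ ∎
    where
    open ≡-Reasoning
    H : Tuple → ℚ
    H m = δ (take 2 n) (take 2 m) * ecoef (drop 2 n) (drop 2 m)
    G : Tuple → Tuple → ℚ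
    G t m = δ t (take 2 m) * (v (drop 2 m) * (δ (take 2 n) t * ecoef (drop 2 n) (drop 2 m)))
    mv : ∀ t → IsS p 2 t → ∀ m → (e t * Φ t v m) * H m ≡ e t * G t m
    mv t@(t1 ∷ t2 ∷ []) _ m = δ-move₂ (e t) t (take 2 m) (take 2 n) (v (drop 2 m)) (ecoef (drop 2 n) (drop 2 m))
    z : ∀ t → IsS p 2 t → Σ[ S N 4 ] (G t) ≡ 0ℚ
    z t@(t1 ∷ t2 ∷ []) (refl , st , ot) = begin
      Σ[ S N 4 ] (λ m → δ t (take 2 m) * g (drop 2 m))
        ≡⟨ Σ-S-δ-prefix N 2 1 t refl ot g ⟩
      Σ[ S (N ∸ sum t) 2 ] g
        ≡⟨ cong (λ k → Σ[ S (N ∸ k) 2 ] g) st ⟩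
      Σ[ S M 2 ] g
        ≡⟨ Σ-*-pull (S M 2) v (ecoef (drop 2 n)) (δ (take 2 n) t) ⟩
      δ (take 2 n) t * Σ[ S M 2 ] (λ m → v m * ecoef (drop 2 n) m)
        ≡⟨ trans (𝟙-*-cong (take 2 n ≟T t) (λ eq → v∈ker (drop 2 n) (IsS⇒∈S M 2 (drop 2 n) (IsS-drop₂ N p n t isn st eq)))) (QP.*-zeroʳ (δ (take 2 n) t)) ⟩
      0ℚ ∎
      where
      g : Tuple → ℚ
      g m'' = v m'' * (δ (take 2 n) t * ecoef (drop 2 n) m'')

lemma4p1 : (N : ℕ)
    → ((p : ℕ) → Odd p → 3 ≤ p → (v : Vect)
    → InKer (N ∸ p) 3 (ᵗ E) v
    → (act N 4 (Ψ (N ∸ p) 3 (p ∷ []) v) (ᵗ E) ≈[ N , 4 ] Φ (p ∷ []) v)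
    × InKer N 4 (ᵗ Eq 3 4) (Φ (p ∷ []) v))
    × ((p : ℕ) → Even p → 6 ≤ p → (p₁ p₂ : ℕ) → (p₁ ∷ p₂ ∷ []) ∈ S p 2 → (v : Vect)
    → InKer (N ∸ p) 2 (ᵗ E) v
    → (act N 4 (act N 4 (Ψ (N ∸ p) 2 (p₁ ∷ p₂ ∷ []) v) (ᵗ E)) (ᵗ Eq 3 4)
    ≈[ N , 4 ] lincomb (S p 2) (λ t → ecoef t (p₁ ∷ p₂ ∷ [])) (λ t → Φ t v))
    × InKer N 4 (ᵗ Eq 2 4)
    (act N 4 (act N 4 (Ψ (N ∸ p) 2 (p₁ ∷ p₂ ∷ []) v) (ᵗ E)) (ᵗ Eq 3 4)))
lemma4p1 N =
  (λ p op p≥3 v v∈ker → Ψ-ᵗE≈Φ₄ N p op p≥3 v v∈ker , Φ∈ker-ᵗE⁽³⁾ N p op p≥3 v v∈ker) ,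
  (λ p _ _ p₁ p₂ mem v v∈ker →
     let isp = ∈S⇒IsS p 2 (p₁ ∷ p₂ ∷ []) mem in
     (λ n n∈ → PartII.Ψ₂-ᵗE-ᵗE⁽³⁾≈lincomb N p p₁ p₂ isp v v∈ker n (∈S⇒IsS N 4 n n∈)) ,
     (λ n n∈ → PartII.lincomb∈ker-ᵗE⁽²⁾ N p p₁ p₂ isp v v∈ker n (∈S⇒IsS N 4 n n∈)))
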